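{- Let $n_{1},n_{2}$ be positive integers and $G:=C_{n_{1}}\times C_{n_{2}}$. Then $\operatorname{Sha}_{\omega}^{2}(G,J_{G})\cong\mathbb{Z}/\gcd(n_{1},n_{2})$.
   Context: $C_n$ is the cyclic group of order $n$. $J_G$ is the cokernel of the $G$-map $\mathbb{Z}\to\mathbb{Z}[G]$ (the regular module $\operatorname{Ind}_{\{1\}}^G\mathbb{Z}$) sending $1$ to $\sum_{g\in G}g$. $\operatorname{Sha}^2_\omega(G,M):=\ker\big(H^2(G,M)\to\bigoplus_{D}H^2(D,M)\big)$, $D$ ranging over cyclic subgroups of $G$. -}

module Defs where

open import Data.Nat as ℕ using (ℕ; zero; suc; NonZero; _∸_)
open import Data.Nat.DivMod using (_mod_)
open import Data.Nat.GCD using (gcd)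
open import Data.Nat.Divisibility using (_∣_)
open import Data.Fin using (Fin; toℕ)
open import Data.Integer as ℤ using (ℤ)
open import Data.Product using (Σ; ∃; _×_; _,_)
open import Data.Unit using (⊤)
open import Relation.Binary.PropositionalEquality using (_≡_)

_≡_[mod_] : ℤ → ℤ → ℕ → Set
a ≡ b [mod d ] = d ∣ ℤ.∣ a ℤ.- b ∣

module CohomologyOf (n₁ n₂ : ℕ) .{{nz₁ : NonZero n₁}} .{{nz₂ : NonZero n₂}} where

  G : Set
  G = Fin n₁ × Fin n₂

  infixl 6 _+G_
  _+G_ : G → G → G
  (a , b) +G (c , d) = ((toℕ a ℕ.+ toℕ c) mod n₁) , ((toℕ b ℕ.+ toℕ d) mod n₂)

  -G_ : G → G
  -G (a , b) = ((n₁ ∸ toℕ a) mod n₁) , ((n₂ ∸ toℕ b) mod n₂)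

  0G : G
  0G = (0 mod n₁) , (0 mod n₂)

  _·G_ : ℕ → G → G
  zero  ·G x = 0G
  suc k ·G x = x +G (k ·G x)

  ⟨_⟩ : G → G → Set
  ⟨ x ⟩ g = ∃ λ (k : ℕ) → g ≡ k ·G x

  -- Z[G] = Ind_{1}^G Z, elements f ↔ Σ_h f(h)·h.
  ZG : Set
  ZG = G → ℤ

  -- G-action on Z[G]:  g · (Σ f(h) h) = Σ f(h) (g+h), i.e. (g·f)(h) = f(h - g).
  act : G → ZG → ZG
  act g f h = f (h +G (-G g))

  _+Z_ _-Z_ : ZG → ZG → ZG
  (f +Z f') h = f h ℤ.+ f' h
  (f -Z f') h = f h ℤ.- f' h

  0Z : ZG
  0Z _ = ℤ.0ℤ

  -- J_G = Z[G] / Z·(Σ_g g): two representatives are equal in J_G iff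
  -- their difference is an integer multiple of the norm element, i.e. constant.
  _≈J_ : ZG → ZG → Set
  f ≈J f' = ∃ λ (c : ℤ) → ∀ h → f h ≡ f' h ℤ.+ c

  -- Inhomogeneous cochains with values in J_G (via representatives in Z[G]).
  C¹ C² : Set
  C¹ = G → ZG
  C² = G → G → ZG

  _+C_ _-C_ : C² → C² → C²
  (φ +C φ') g h = φ g h +Z φ' g h
  (φ -C φ') g h = φ g h -Z φ' g h

  δ¹ : C¹ → C²
  δ¹ ψ g h = (act g (ψ h) -Z ψ (g +G h)) +Z ψ g

  δ² : C² → G → G → G → ZG
  δ² φ g h k = ((act g (φ h k) -Z φ (g +G h) k) +Z φ g (h +G k)) -Z φ g h

  Is2Cocycle : C² → Set
  Is2Cocycle φ = ∀ g h k → δ² φ g h k ≈J 0Z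

  -- The restriction of φ to the subgroup S (a predicate on G) is a
  -- 2-coboundary of S with values in J_G, i.e. res_S [φ] = 0 in H²(S, J_G).
  IsCoboundaryOn : (G → Set) → C² → Set
  IsCoboundaryOn S φ = ∃ λ (ψ : C¹) → ∀ g h → S g → S h → φ g h ≈J δ¹ ψ g h

  Is2Coboundary : C² → Set
  Is2Coboundary = IsCoboundaryOn (λ _ → ⊤)

  -- 2-cocycles whose class lies in Sha²_ω(G, J_G): trivial on every cyclic subgroup.
  IsShaCocycle : C² → Set
  IsShaCocycle φ = Is2Cocycle φ × (∀ (x : G) → IsCoboundaryOn ⟨ x ⟩ φ)

  _∼_ : C² → C² → Set
  φ ∼ φ' = Is2Coboundary (φ -C φ')

  -- Sha²_ω(G, J_G) ≅ Z/d as abelian groups: a map F on representatives that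
  -- is well defined on classes, additive, injective and surjective mod d.
  ShaIsoZmod : ℕ → Set
  ShaIsoZmod d = Σ (C² → ℤ) λ F →
      (∀ φ φ' → IsShaCocycle φ → IsShaCocycle φ' → φ ∼ φ' → F φ ≡ F φ' [mod d ])
    × (∀ φ φ' → IsShaCocycle φ → IsShaCocycle φ' → F (φ +C φ') ≡ F φ ℤ.+ F φ' [mod d ])
    × (∀ φ φ' → IsShaCocycle φ → IsShaCocycle φ' → F φ ≡ F φ' [mod d ] → φ ∼ φ')
    × (∀ (m : ℤ) → Σ C² λ φ → IsShaCocycle φ × F φ ≡ m [mod d ])

{-# OPTIONS --safe #-}
-- Since ℤ[G] is cohomologically trivial, the class of a J_G-valued 2-cocycle φ is determined by the
-- integral 3-cocycle c = δ²φ (a constant function): the connecting map H²(G, J_G) → H³(G, ℤ) is an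
-- isomorphism. Summing c over its first argument gives an integral 2-cochain B with δB = |G|·c, i.e.
-- a central extension of G by ℤ/|G|. The commutator B(e₁,e₂) − B(e₂,e₁) of the lifts of the two
-- generators is divisible by lcm(n₁,n₂); the quotient F, read modulo gcd(n₁,n₂), is the invariant.
-- F is additive and vanishes on coboundaries. If F vanishes the two lifts commute, so the extension
-- splits up to the carry cocycles of C_{n₁} × C_{n₂}; hence c is integrally exact and φ is a
-- coboundary. Conversely, multiples of the 3-cocycle δ(ℓ₁ ∪ ℓ₂)/gcd(n₁,n₂), where ℓᵢ lifts the i-th
-- coordinate to ℤ, realise every value of F, and on each cyclic subgroup this 3-cocycle is an explicit
-- integral coboundary, so these classes lie in Sha²_ω.
module Submission where

open import Defs
open import Algebra.Bundles using (AbelianGroup; Monoid)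
open import Algebra.Definitions using (Associative)
open import Algebra.Structures using (IsAbelianGroup)
open import Data.Fin using (Fin; toℕ; fromℕ<)
open import Data.Fin.Properties as Finₚ using (toℕ-injective; toℕ-fromℕ<; toℕ<n; *↔×; any?)
open import Data.Integer as ℤ using (ℤ; +_; 0ℤ; 1ℤ; -1ℤ; _+_; _-_; _*_; -_)
import Data.Integer.Properties as ℤP
open import Data.Integer.Divisibility.Signed as Signed using (divides; ∣ᵤ⇒∣; ∣⇒∣ᵤ)
open import Data.Integer.Tactic.RingSolver using (solve-∀)
open import Data.List using (List; map; upTo)
open import Data.List.Extrema.Nat using (argmin; argmin-all; f[argmin]≤f[xs])
open import Data.List.Membership.Propositional.Properties using (∈-map⁺; ∈-upTo⁺)
import Data.List.Relation.Unary.All as All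
open import Data.List.Relation.Unary.All.Properties using (map⁺)
open import Data.Nat as ℕ using (ℕ; zero; suc; NonZero; _∸_; _%_; _/_; _≤_)
open import Data.Nat.DivMod
import Data.Nat.Divisibility as ℕD
open import Data.Nat.GCD using (gcd; gcd[m,n]≢0; gcd[m,n]∣m; gcd[m,n]∣n)
open import Data.Nat.LCM using (lcm; lcm-least; gcd*lcm)
import Data.Nat.Properties as ℕP
open import Data.Product using (∃; _×_; _,_; proj₁; proj₂)
open import Data.Product.Properties using (×-≡,≡→≡; ≡-dec)
open import Data.Sum using (inj₁)
open import Data.Unit using (⊤; tt)
open import Function using (_∘_; _↔_; Inverse; mk↔ₛ′)
open import Function.Construct.Composition using (_↔-∘_)
open import Function.Construct.Symmetry using (↔-sym)
open import Relation.Binary.Bundles using (Setoid)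
open import Relation.Binary.PropositionalEquality
open import Relation.Binary.Structures using (IsEquivalence)
import Relation.Binary.Reasoning.Setoid as SetoidReasoning
open import Relation.Nullary using (Dec; yes; no; contradiction)

open import Algebra.Properties.Semiring.Sum ℤP.+-*-semiring
  using (sum; sum-cong-≗; ∑-distrib-+; *-distribˡ-sum; sum-permute)

-- Unlike _≡_[mod_] (divisibility of ∣ a − b ∣), this relation determines a and b from its type,
-- so they can be inferred and it can serve as a setoid.
infix 4 _≡_⟨mod_⟩
record _≡_⟨mod_⟩ (a b : ℤ) (d : ℕ) : Set where
  constructor _,_
  field
    quotient : ℤ
    equality : a ≡ b + quotient * + d

infixr 4 _,_

private
  refl-identity : ∀ a d → a ≡ a + 0ℤ * d
  refl-identity = solve-∀

  sym-identity : ∀ b q d → b ≡ (b + q * d) + (- q) * d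
  sym-identity = solve-∀

  trans-identity : ∀ c q r d → (c + r * d) + q * d ≡ c + (r + q) * d
  trans-identity = solve-∀

  +-identity : ∀ b q e r d → (b + q * d) + (e + r * d) ≡ (b + e) + (q + r) * d
  +-identity = solve-∀

  neg-identity : ∀ b q d → - (b + q * d) ≡ - b + (- q) * d
  neg-identity = solve-∀

  *-identity : ∀ k b q d → k * (b + q * d) ≡ k * b + (k * q) * d
  *-identity = solve-∀

  intro-identity : ∀ a q d → a ≡ (a + q * d) + (- q) * d
  intro-identity = solve-∀

  difference-identity : ∀ b q d → (b + q * d) - b ≡ 0ℤ + q * d
  difference-identity = solve-∀

  scale-identity : ∀ b q d L → (b + q * d) * L ≡ b * L + q * (d * L)
  scale-identity = solve-∀

  weaken-identity : ∀ b q k d → b + q * (k * d) ≡ b + q * k * d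
  weaken-identity = solve-∀

  to-difference : ∀ a b q d → a ≡ b + q * d → a - b ≡ q * d
  to-difference a b q d refl = identity b q d
    where
    identity : ∀ b q d → (b + q * d) - b ≡ q * d
    identity = solve-∀

  from-difference : ∀ a b q d → a - b ≡ q * d → a ≡ b + q * d
  from-difference a b q d eq = trans (identity a b) (cong (λ x → b + x) eq)
    where
    identity : ∀ a b → a ≡ b + (a - b)
    identity = solve-∀

module _ {d : ℕ} where

  ⟨mod⟩-reflexive : ∀ {a b} → a ≡ b → a ≡ b ⟨mod d ⟩
  ⟨mod⟩-reflexive {a} refl = 0ℤ , refl-identity a (+ d)

  ⟨mod⟩-refl : ∀ {a} → a ≡ a ⟨mod d ⟩
  ⟨mod⟩-refl = ⟨mod⟩-reflexive refl

  ⟨mod⟩-sym : ∀ {a b} → a ≡ b ⟨mod d ⟩ → b ≡ a ⟨mod d ⟩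
  ⟨mod⟩-sym {b = b} (q , refl) = - q , sym-identity b q (+ d)

  ⟨mod⟩-trans : ∀ {a b c} → a ≡ b ⟨mod d ⟩ → b ≡ c ⟨mod d ⟩ → a ≡ c ⟨mod d ⟩
  ⟨mod⟩-trans {c = c} (q , refl) (r , refl) = r + q , trans-identity c q r (+ d)

  ⟨mod⟩-+ : ∀ {a b c e} → a ≡ b ⟨mod d ⟩ → c ≡ e ⟨mod d ⟩ → a + c ≡ b + e ⟨mod d ⟩
  ⟨mod⟩-+ {b = b} {e = e} (q , refl) (r , refl) = q + r , +-identity b q e r (+ d)

  ⟨mod⟩-+ˡ : ∀ a {b c} → b ≡ c ⟨mod d ⟩ → a + b ≡ a + c ⟨mod d ⟩
  ⟨mod⟩-+ˡ a = ⟨mod⟩-+ (⟨mod⟩-refl {a})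

  ⟨mod⟩-+ʳ : ∀ c {a b} → a ≡ b ⟨mod d ⟩ → a + c ≡ b + c ⟨mod d ⟩
  ⟨mod⟩-+ʳ c a≡b = ⟨mod⟩-+ a≡b (⟨mod⟩-refl {c})

  ⟨mod⟩-neg : ∀ {a b} → a ≡ b ⟨mod d ⟩ → - a ≡ - b ⟨mod d ⟩
  ⟨mod⟩-neg {b = b} (q , refl) = - q , neg-identity b q (+ d)

  ⟨mod⟩-*ˡ : ∀ k {a b} → a ≡ b ⟨mod d ⟩ → k * a ≡ k * b ⟨mod d ⟩
  ⟨mod⟩-*ˡ k {b = b} (q , refl) = k * q , *-identity k b q (+ d)

  ⟨mod⟩-* : ∀ {a b c e} → a ≡ b ⟨mod d ⟩ → c ≡ e ⟨mod d ⟩ → a * c ≡ b * e ⟨mod d ⟩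
  ⟨mod⟩-* {a} {b} {c} {e} a≡b c≡e = ⟨mod⟩-trans
    (subst₂ (λ x y → x ≡ y ⟨mod d ⟩) (ℤP.*-comm c a) (ℤP.*-comm c b) (⟨mod⟩-*ˡ c a≡b)) (⟨mod⟩-*ˡ b c≡e)

  ⟨mod⟩-intro : ∀ {a b} q → a + q * + d ≡ b → a ≡ b ⟨mod d ⟩
  ⟨mod⟩-intro {a} q refl = - q , intro-identity a q (+ d)

  ⟨mod⟩-difference⁺ : ∀ {a b} → a ≡ b ⟨mod d ⟩ → a - b ≡ 0ℤ ⟨mod d ⟩
  ⟨mod⟩-difference⁺ {b = b} (q , refl) = q , difference-identity b q (+ d)

  ⟨mod⟩-difference⁻ : ∀ {a b} → a - b ≡ 0ℤ ⟨mod d ⟩ → a ≡ b ⟨mod d ⟩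
  ⟨mod⟩-difference⁻ {a} {b} (q , a-b≡qd) = q , from-difference a b q (+ d) (trans a-b≡qd (ℤP.+-identityˡ _))

  ⟨mod⟩-scale : ∀ L {a b} → a ≡ b ⟨mod d ⟩ → a * + L ≡ b * + L ⟨mod d ℕ.* L ⟩
  ⟨mod⟩-scale L {b = b} (q , refl) =
    q , trans (scale-identity b q (+ d) (+ L)) (cong (λ x → b * + L + q * x) (sym (ℤP.pos-* d L)))

  ⟨mod⟩-unscale : ∀ L .{{_ : NonZero L}} {a b} → a * + L ≡ b * + L ⟨mod d ℕ.* L ⟩ → a ≡ b ⟨mod d ⟩
  ⟨mod⟩-unscale L {a} {b} (q , aL≡bL+qdL) = q , ℤP.*-cancelʳ-≡ a (b + q * + d) (+ L)
    (trans aL≡bL+qdL (trans (cong (λ x → b * + L + q * x) (ℤP.pos-* d L)) (sym (scale-identity b q (+ d) (+ L)))))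

  ⟨mod⟩-weaken : ∀ {K a b} → d ℕD.∣ K → a ≡ b ⟨mod K ⟩ → a ≡ b ⟨mod d ⟩
  ⟨mod⟩-weaken {b = b} (ℕD.divides k refl) (q , refl) =
    q * + k , trans (cong (λ x → b + q * x) (ℤP.pos-* k d)) (weaken-identity b q (+ k) (+ d))

  ⟨mod⟩-isEquivalence : IsEquivalence (λ a b → a ≡ b ⟨mod d ⟩)
  ⟨mod⟩-isEquivalence = record { refl = ⟨mod⟩-refl ; sym = ⟨mod⟩-sym ; trans = ⟨mod⟩-trans }

  ⟨mod⟩⇒[mod] : ∀ {a b} → a ≡ b ⟨mod d ⟩ → a ≡ b [mod d ]
  ⟨mod⟩⇒[mod] {a} {b} (q , eq) = ∣⇒∣ᵤ {+ d} {a - b} (divides q (to-difference a b q (+ d) eq))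

  [mod]⇒⟨mod⟩ : ∀ a b → a ≡ b [mod d ] → a ≡ b ⟨mod d ⟩
  [mod]⇒⟨mod⟩ a b a≡b with divides q eq ← ∣ᵤ⇒∣ {+ d} {a - b} a≡b = q , from-difference a b q (+ d) eq

⟨mod⟩-setoid : ℕ → Setoid _ _
⟨mod⟩-setoid d = record { isEquivalence = ⟨mod⟩-isEquivalence {d} }

module ⟨mod⟩-Reasoning (d : ℕ) = SetoidReasoning (⟨mod⟩-setoid d)

⟨mod⟩-cancel-factor : ∀ a b x .{{_ : NonZero a}} → + a * x ≡ 0ℤ ⟨mod a ℕ.* b ⟩ → + b Signed.∣ x
⟨mod⟩-cancel-factor a b x (q , ax≡qab) = divides q (ℤP.*-cancelˡ-≡ (+ a) x (q * + b) (begin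
  + a * x              ≡⟨ ax≡qab ⟩
  0ℤ + q * + (a ℕ.* b) ≡⟨ ℤP.+-identityˡ _ ⟩
  q * + (a ℕ.* b)      ≡⟨ cong (q *_) (ℤP.pos-* a b) ⟩
  q * (+ a * + b)      ≡⟨ rearrange q (+ a) (+ b) ⟩
  + a * (q * + b)      ∎))
  where
  open ≡-Reasoning
  rearrange : ∀ q a b → q * (a * b) ≡ a * (q * b)
  rearrange = solve-∀

-- The value for k ∤ i is junk; being opaque, exactQuotient is only ever used through exactQuotient-unique.
opaque
  exactQuotient : ℤ → ℤ → ℤ
  exactQuotient k i with k Signed.∣? i
  ... | yes k∣i = Signed.quotient k∣i
  ... | no  _   = 0ℤ

  exactQuotient-unique : ∀ k .{{_ : ℤ.NonZero k}} i x → i ≡ x * k → exactQuotient k i ≡ x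
  exactQuotient-unique k i x i≡xk with k Signed.∣? i
  ... | yes (divides q i≡qk) = ℤP.*-cancelʳ-≡ q x k (trans (sym i≡qk) i≡xk)
  ... | no  k∤i              = contradiction (divides x i≡xk) k∤i

private
  alternating-+ : ∀ a b c e a′ b′ c′ e′ →
    (((a + a′) - (b + b′)) + (c + c′)) - (e + e′) ≡ (((a - b) + c) - e) + (((a′ - b′) + c′) - e′)
  alternating-+ = solve-∀

  alternating-- : ∀ a b c e a′ b′ c′ e′ →
    (((a - a′) - (b - b′)) + (c - c′)) - (e - e′) ≡ (((a - b) + c) - e) - (((a′ - b′) + c′) - e′)
  alternating-- = solve-∀

  alternating-* : ∀ k a b c e → ((k * a - k * b) + k * c) - k * e ≡ k * (((a - b) + c) - e)
  alternating-* = solve-∀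

  alternating₅-* : ∀ k a b c e f → (((k * a - k * b) + k * c) - k * e) + k * f ≡ k * ((((a - b) + c) - e) + f)
  alternating₅-* = solve-∀

  alternating-const : ∀ a → ((a - a) + a) - a ≡ 0ℤ
  alternating-const = solve-∀

  δδ-identity₂ : ∀ a b c e f i → (((a - b) + c) - ((a - e) + f)) + ((b - e) + i) - ((c - f) + i) ≡ 0ℤ
  δδ-identity₂ = solve-∀

  δδ-identity₃ : ∀ a₁ a₂ a₃ a₄ a₅ a₆ a₇ a₈ a₉ a₁₀ →
    ((((((a₁ - a₂) + a₃) - a₄) - (((a₁ - a₅) + a₆) - a₇)) + (((a₂ - a₅) + a₈) - a₉))
      - (((a₃ - a₆) + a₈) - a₁₀)) + (((a₄ - a₇) + a₉) - a₁₀) ≡ 0ℤ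
  δδ-identity₃ = solve-∀

  leibniz-identity : ∀ a b ab c e ce → ((b * e - ab * e) + a * ce) - a * c ≡ ((b - ab) + a) * e - a * ((e - ce) + c)
  leibniz-identity = solve-∀

module IntegralCochains {A : Set} (_∙_ : A → A → A) where

  δ₁ : (A → ℤ) → A → A → ℤ
  δ₁ f g h = (f h - f (g ∙ h)) + f g

  δ₂ : (A → A → ℤ) → A → A → A → ℤ
  δ₂ b g h k = ((b h k - b (g ∙ h) k) + b g (h ∙ k)) - b g h

  δ₃ : (A → A → A → ℤ) → A → A → A → A → ℤ
  δ₃ c g h k l = (((c h k l - c (g ∙ h) k l) + c g (h ∙ k) l) - c g h (k ∙ l)) + c g h k

  infixl 7 _∪_
  _∪_ : (A → ℤ) → (A → ℤ) → A → A → ℤ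
  (f ∪ f′) g h = f g * f′ h

  δ₂-cong : ∀ {b b′} → (∀ g h → b g h ≡ b′ g h) → ∀ g h k → δ₂ b g h k ≡ δ₂ b′ g h k
  δ₂-cong eq g h k = cong₂ _-_ (cong₂ _+_ (cong₂ _-_ (eq h k) (eq (g ∙ h) k)) (eq g (h ∙ k))) (eq g h)

  δ₂-congOn : ∀ (S : A → Set) → (∀ {g h} → S g → S h → S (g ∙ h)) → ∀ {b b′} →
              (∀ {g h} → S g → S h → b g h ≡ b′ g h) → ∀ {g h k} → S g → S h → S k → δ₂ b g h k ≡ δ₂ b′ g h k
  δ₂-congOn S S-∙ eq Sg Sh Sk =
    cong₂ _-_ (cong₂ _+_ (cong₂ _-_ (eq Sh Sk) (eq (S-∙ Sg Sh) Sk)) (eq Sg (S-∙ Sh Sk))) (eq Sg Sh)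

  δ₂-+ : ∀ b b′ g h k → δ₂ (λ u v → b u v + b′ u v) g h k ≡ δ₂ b g h k + δ₂ b′ g h k
  δ₂-+ b b′ g h k = alternating-+ (b h k) (b (g ∙ h) k) (b g (h ∙ k)) (b g h)
                                 (b′ h k) (b′ (g ∙ h) k) (b′ g (h ∙ k)) (b′ g h)

  δ₂-- : ∀ b b′ g h k → δ₂ (λ u v → b u v - b′ u v) g h k ≡ δ₂ b g h k - δ₂ b′ g h k
  δ₂-- b b′ g h k = alternating-- (b h k) (b (g ∙ h) k) (b g (h ∙ k)) (b g h)
                                 (b′ h k) (b′ (g ∙ h) k) (b′ g (h ∙ k)) (b′ g h)

  δ₂-*ˡ : ∀ x b g h k → δ₂ (λ u v → x * b u v) g h k ≡ x * δ₂ b g h k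
  δ₂-*ˡ x b g h k = alternating-* x (b h k) (b (g ∙ h) k) (b g (h ∙ k)) (b g h)

  δ₂-const : ∀ x g h k → δ₂ (λ _ _ → x) g h k ≡ 0ℤ
  δ₂-const x g h k = alternating-const x

  δ₂-∪ : ∀ f f′ g h k → δ₂ (f ∪ f′) g h k ≡ δ₁ f g h * f′ k - f g * δ₁ f′ h k
  δ₂-∪ f f′ g h k = leibniz-identity (f g) (f h) (f (g ∙ h)) (f′ h) (f′ k) (f′ (h ∙ k))

  δ₃-cong : ∀ {c c′} → (∀ g h k → c g h k ≡ c′ g h k) → ∀ g h k l → δ₃ c g h k l ≡ δ₃ c′ g h k l
  δ₃-cong eq g h k l =
    cong₂ _+_ (cong₂ _-_ (cong₂ _+_ (cong₂ _-_ (eq h k l) (eq (g ∙ h) k l)) (eq g (h ∙ k) l)) (eq g h (k ∙ l))) (eq g h k)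

  δ₃-*ˡ : ∀ x c g h k l → δ₃ (λ u v w → x * c u v w) g h k l ≡ x * δ₃ c g h k l
  δ₃-*ˡ x c g h k l = alternating₅-* x (c h k l) (c (g ∙ h) k l) (c g (h ∙ k) l) (c g h (k ∙ l)) (c g h k)

  module _ (assoc : Associative _≡_ _∙_) where

    δ₂∘δ₁≡0 : ∀ f g h k → δ₂ (δ₁ f) g h k ≡ 0ℤ
    δ₂∘δ₁≡0 f g h k rewrite assoc g h k =
      δδ-identity₂ (f k) (f (h ∙ k)) (f h) (f (g ∙ (h ∙ k))) (f (g ∙ h)) (f g)

    δ₃∘δ₂≡0 : ∀ b g h k l → δ₃ (δ₂ b) g h k l ≡ 0ℤ
    δ₃∘δ₂≡0 b g h k l rewrite assoc g h k | assoc h k l =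
      δδ-identity₃ (b k l) (b (h ∙ k) l) (b h (k ∙ l)) (b h k) (b (g ∙ (h ∙ k)) l) (b (g ∙ h) (k ∙ l))
                   (b (g ∙ h) k) (b g (h ∙ (k ∙ l))) (b g (h ∙ k)) (b g h)

    δ₁≡M*κ⇒δ₂κ≡0 : ∀ M .{{_ : NonZero M}} f κ → (∀ g h → δ₁ f g h ≡ + M * κ g h) → ∀ g h k → δ₂ κ g h k ≡ 0ℤ
    δ₁≡M*κ⇒δ₂κ≡0 M f κ δ₁f≡Mκ g h k = ℤP.*-cancelˡ-≡ (+ M) (δ₂ κ g h k) 0ℤ (begin
      + M * δ₂ κ g h k                ≡⟨ δ₂-*ˡ (+ M) κ g h k ⟨
      δ₂ (λ u v → + M * κ u v) g h k  ≡⟨ δ₂-cong δ₁f≡Mκ g h k ⟨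
      δ₂ (δ₁ f) g h k                 ≡⟨ δ₂∘δ₁≡0 f g h k ⟩
      0ℤ                              ≡⟨ ℤP.*-zeroʳ (+ M) ⟨
      + M * 0ℤ                        ∎)
      where open ≡-Reasoning

    δ₂≡M*c⇒δ₃c≡0 : ∀ M .{{_ : NonZero M}} b c → (∀ g h k → δ₂ b g h k ≡ + M * c g h k) → ∀ g h k l → δ₃ c g h k l ≡ 0ℤ
    δ₂≡M*c⇒δ₃c≡0 M b c δ₂b≡Mc g h k l = ℤP.*-cancelˡ-≡ (+ M) (δ₃ c g h k l) 0ℤ (begin
      + M * δ₃ c g h k l                    ≡⟨ δ₃-*ˡ (+ M) c g h k l ⟨
      δ₃ (λ u v w → + M * c u v w) g h k l  ≡⟨ δ₃-cong δ₂b≡Mc g h k l ⟨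
      δ₃ (δ₂ b) g h k l                     ≡⟨ δ₃∘δ₂≡0 b g h k l ⟩
      0ℤ                                    ≡⟨ ℤP.*-zeroʳ (+ M) ⟨
      + M * 0ℤ                              ∎)
      where open ≡-Reasoning

module FiniteSum {A : Set} {k : ℕ} (enumeration : Fin k ↔ A) where

  open Inverse enumeration using (to; from; strictlyInverseˡ)

  ∑ : (A → ℤ) → ℤ
  ∑ f = sum (f ∘ to)

  ∑-cong : ∀ {f g} → (∀ x → f x ≡ g x) → ∑ f ≡ ∑ g
  ∑-cong f≗g = sum-cong-≗ (f≗g ∘ to)

  ∑-+ : ∀ f g → ∑ (λ x → f x + g x) ≡ ∑ f + ∑ g
  ∑-+ f g = ∑-distrib-+ (f ∘ to) (g ∘ to)

  ∑-*ˡ : ∀ c f → ∑ (λ x → c * f x) ≡ c * ∑ f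
  ∑-*ˡ c f = sym (*-distribˡ-sum c (f ∘ to))

  ∑-neg : ∀ f → ∑ (λ x → - f x) ≡ - ∑ f
  ∑-neg f = begin
    ∑ (λ x → - f x)      ≡⟨ ∑-cong (λ x → sym (ℤP.-1*i≡-i (f x))) ⟩
    ∑ (λ x → -1ℤ * f x)  ≡⟨ ∑-*ˡ -1ℤ f ⟩
    -1ℤ * ∑ f            ≡⟨ ℤP.-1*i≡-i (∑ f) ⟩
    - ∑ f                ∎
    where open ≡-Reasoning

  ∑-- : ∀ f g → ∑ (λ x → f x - g x) ≡ ∑ f - ∑ g
  ∑-- f g = trans (∑-+ f (λ x → - g x)) (cong (λ s → ∑ f + s) (∑-neg g))

  ∑-const : ∀ c → ∑ (λ _ → c) ≡ + k * c
  ∑-const c = sum-const k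
    where
    sum-const : ∀ j → sum {j} (λ _ → c) ≡ + j * c
    sum-const zero    = sym (ℤP.*-zeroˡ c)
    sum-const (suc j) = trans (cong (λ s → c + s) (sum-const j)) (sym (ℤP.suc-* (+ j) c))

  ∑-bijection : ∀ (π : A ↔ A) f → ∑ (f ∘ Inverse.to π) ≡ ∑ f
  ∑-bijection π f = sym (begin
    ∑ f                                             ≡⟨ sum-permute {k} {k} (f ∘ to) (↔-sym enumeration ↔-∘ (π ↔-∘ enumeration)) ⟩
    sum (λ i → f (to (from (Inverse.to π (to i)))))  ≡⟨ sum-cong-≗ (λ i → cong f (strictlyInverseˡ (Inverse.to π (to i)))) ⟩
    ∑ (f ∘ Inverse.to π)                            ∎)
    where open ≡-Reasoning


module ℤmod (m : ℕ) .{{_ : NonZero m}} where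

  open ≡-Reasoning

  infixl 6 _⊕_
  _⊕_ : Fin m → Fin m → Fin m
  a ⊕ b = (toℕ a ℕ.+ toℕ b) mod m

  ⊖_ : Fin m → Fin m
  ⊖ a = (m ∸ toℕ a) mod m

  𝟘 𝟙 : Fin m
  𝟘 = 0 mod m
  𝟙 = 1 mod m

  toℕ-mod : ∀ x → toℕ (x mod m) ≡ x % m
  toℕ-mod x = toℕ-fromℕ< (m%n<n x m)

  0%m≡0 : 0 % m ≡ 0
  0%m≡0 = m<n⇒m%n≡m (ℕ.>-nonZero⁻¹ m)

  toℕ-𝟘 : toℕ 𝟘 ≡ 0
  toℕ-𝟘 = trans (toℕ-mod 0) 0%m≡0

  mod-cong : ∀ {x y} → x % m ≡ y % m → x mod m ≡ y mod m
  mod-cong {x} {y} eq = toℕ-injective (trans (toℕ-mod x) (trans eq (sym (toℕ-mod y))))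

  toℕ-mod-id : ∀ a → toℕ a mod m ≡ a
  toℕ-mod-id a = toℕ-injective (trans (toℕ-mod (toℕ a)) (m<n⇒m%n≡m (toℕ<n a)))

  mod-absorbˡ : ∀ x y → (toℕ (x mod m) ℕ.+ y) mod m ≡ (x ℕ.+ y) mod m
  mod-absorbˡ x y = mod-cong (begin
    (toℕ (x mod m) ℕ.+ y) % m     ≡⟨ cong (λ z → (z ℕ.+ y) % m) (toℕ-mod x) ⟩
    (x % m ℕ.+ y) % m             ≡⟨ %-distribˡ-+ (x % m) y m ⟩
    (x % m % m ℕ.+ y % m) % m     ≡⟨ cong (λ z → (z ℕ.+ y % m) % m) (m%n%n≡m%n x m) ⟩
    (x % m ℕ.+ y % m) % m         ≡⟨ %-distribˡ-+ x y m ⟨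
    (x ℕ.+ y) % m                 ∎)

  mod-absorbʳ : ∀ x y → (x ℕ.+ toℕ (y mod m)) mod m ≡ (x ℕ.+ y) mod m
  mod-absorbʳ x y = begin
    (x ℕ.+ toℕ (y mod m)) mod m  ≡⟨ cong (_mod m) (ℕP.+-comm x _) ⟩
    (toℕ (y mod m) ℕ.+ x) mod m  ≡⟨ mod-absorbˡ y x ⟩
    (y ℕ.+ x) mod m              ≡⟨ cong (_mod m) (ℕP.+-comm y x) ⟩
    (x ℕ.+ y) mod m              ∎

  ⊕-comm : ∀ a b → a ⊕ b ≡ b ⊕ a
  ⊕-comm a b = cong (_mod m) (ℕP.+-comm (toℕ a) (toℕ b))

  ⊕-assoc : ∀ a b c → (a ⊕ b) ⊕ c ≡ a ⊕ (b ⊕ c)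
  ⊕-assoc a b c = begin
    (a ⊕ b) ⊕ c                              ≡⟨ mod-absorbˡ (toℕ a ℕ.+ toℕ b) (toℕ c) ⟩
    (toℕ a ℕ.+ toℕ b ℕ.+ toℕ c) mod m        ≡⟨ cong (_mod m) (ℕP.+-assoc (toℕ a) (toℕ b) (toℕ c)) ⟩
    (toℕ a ℕ.+ (toℕ b ℕ.+ toℕ c)) mod m      ≡⟨ mod-absorbʳ (toℕ a) (toℕ b ℕ.+ toℕ c) ⟨
    a ⊕ (b ⊕ c)                              ∎

  ⊕-identityˡ : ∀ a → 𝟘 ⊕ a ≡ a
  ⊕-identityˡ a = trans (mod-absorbˡ 0 (toℕ a)) (toℕ-mod-id a)

  ⊕-inverseʳ : ∀ a → a ⊕ ⊖ a ≡ 𝟘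
  ⊕-inverseʳ a = begin
    a ⊕ ⊖ a                       ≡⟨ mod-absorbʳ (toℕ a) (m ∸ toℕ a) ⟩
    (toℕ a ℕ.+ (m ∸ toℕ a)) mod m ≡⟨ cong (_mod m) (ℕP.m+[n∸m]≡n (ℕP.<⇒≤ (toℕ<n a))) ⟩
    m mod m                       ≡⟨ mod-cong (trans (n%n≡0 m) (sym 0%m≡0)) ⟩
    𝟘                             ∎

  infixr 7 _⊙_
  _⊙_ : ℕ → Fin m → Fin m
  k ⊙ a = (k ℕ.* toℕ a) mod m

  ⊙-suc : ∀ k a → suc k ⊙ a ≡ a ⊕ k ⊙ a
  ⊙-suc k a = sym (mod-absorbʳ (toℕ a) (k ℕ.* toℕ a))

  ⊙-𝟘 : ∀ k → k ⊙ 𝟘 ≡ 𝟘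
  ⊙-𝟘 k = cong (_mod m) (trans (cong (k ℕ.*_) toℕ-𝟘) (ℕP.*-zeroʳ k))

  ⊙-multiple : ∀ q a → (q ℕ.* m) ⊙ a ≡ 𝟘
  ⊙-multiple q a = mod-cong (begin
    (q ℕ.* m ℕ.* toℕ a) % m  ≡⟨ cong (_% m) (ℕP.*-comm (q ℕ.* m) (toℕ a)) ⟩
    (toℕ a ℕ.* (q ℕ.* m)) % m ≡⟨ cong (_% m) (ℕP.*-assoc (toℕ a) q m) ⟨
    (toℕ a ℕ.* q ℕ.* m) % m  ≡⟨ m*n%n≡0 (toℕ a ℕ.* q) m ⟩
    0                        ≡⟨ 0%m≡0 ⟨
    0 % m                    ∎)

  ⊙-one : ∀ a → toℕ a ⊙ 𝟙 ≡ a
  ⊙-one a = trans (mod-cong (begin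
    (toℕ a ℕ.* toℕ 𝟙) % m               ≡⟨ cong (λ z → (toℕ a ℕ.* z) % m) (toℕ-mod 1) ⟩
    (toℕ a ℕ.* (1 % m)) % m             ≡⟨ %-distribˡ-* (toℕ a) (1 % m) m ⟩
    (toℕ a % m ℕ.* (1 % m % m)) % m     ≡⟨ cong (λ z → (toℕ a % m ℕ.* z) % m) (m%n%n≡m%n 1 m) ⟩
    (toℕ a % m ℕ.* (1 % m)) % m         ≡⟨ %-distribˡ-* (toℕ a) 1 m ⟨
    (toℕ a ℕ.* 1) % m                   ≡⟨ cong (_% m) (ℕP.*-identityʳ (toℕ a)) ⟩
    toℕ a % m                           ∎)) (toℕ-mod-id a)

  lift : Fin m → ℤ
  lift a = + toℕ a

  lift-mod : ∀ x → lift (x mod m) + + (x / m) * + m ≡ + x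
  lift-mod x = begin
    + toℕ (x mod m) + + (x / m) * + m  ≡⟨ cong₂ (λ r q → + r + q) (toℕ-mod x) (sym (ℤP.pos-* (x / m) m)) ⟩
    + (x % m) + + (x / m ℕ.* m)          ≡⟨ ℤP.pos-+ (x % m) (x / m ℕ.* m) ⟨
    + (x % m ℕ.+ x / m ℕ.* m)              ≡⟨ cong +_ (m≡m%n+[m/n]*n x m) ⟨
    + x                                    ∎

  carry : Fin m → Fin m → ℤ
  carry a b = + ((toℕ a ℕ.+ toℕ b) / m)

  lift-carry : ∀ a b → (lift b - lift (a ⊕ b)) + lift a ≡ + m * carry a b
  lift-carry a b = begin
    (lift b - lift (a ⊕ b)) + lift a                    ≡⟨ rearrange (lift a) (lift b) (lift (a ⊕ b)) ⟩
    (lift a + lift b) - lift (a ⊕ b)                    ≡⟨ cong (_- lift (a ⊕ b)) (ℤP.pos-+ (toℕ a) (toℕ b)) ⟨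
    + (toℕ a ℕ.+ toℕ b) - lift (a ⊕ b)                    ≡⟨ cong (_- lift (a ⊕ b)) (lift-mod (toℕ a ℕ.+ toℕ b)) ⟨
    (lift (a ⊕ b) + carry a b * + m) - lift (a ⊕ b)   ≡⟨ cancel (lift (a ⊕ b)) (carry a b) (+ m) ⟩
    + m * carry a b                                       ∎
    where
    rearrange : ∀ x y z → (y - z) + x ≡ (x + y) - z
    rearrange = solve-∀
    cancel : ∀ x k M → (x + k * M) - x ≡ M * k
    cancel = solve-∀

module CommutingElements {c ℓ} (M : Monoid c ℓ) where

  open Monoid M using (_∙_; _≈_; assoc; identityˡ; identityʳ; ∙-congˡ; ∙-congʳ)
    renaming (sym to ≈-sym; trans to ≈-trans)
  open import Algebra.Properties.Monoid.Mult M using () renaming (_×_ to _·_)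
  open SetoidReasoning (Monoid.setoid M)

  ·-commute : ∀ {x y} → x ∙ y ≈ y ∙ x → ∀ j → x ∙ j · y ≈ j · y ∙ x
  ·-commute {x} {y} xy≈yx zero    = ≈-trans (identityʳ x) (≈-sym (identityˡ x))
  ·-commute {x} {y} xy≈yx (suc j) = begin
    x ∙ (y ∙ j · y)    ≈⟨ assoc x y (j · y) ⟨
    (x ∙ y) ∙ j · y    ≈⟨ ∙-congʳ xy≈yx ⟩
    (y ∙ x) ∙ j · y    ≈⟨ assoc y x (j · y) ⟩
    y ∙ (x ∙ j · y)    ≈⟨ ∙-congˡ (·-commute xy≈yx j) ⟩
    y ∙ (j · y ∙ x)    ≈⟨ assoc y (j · y) x ⟨
    (y ∙ j · y) ∙ x    ∎

  ·-commute₂ : ∀ {x y} → x ∙ y ≈ y ∙ x → ∀ i j → i · x ∙ j · y ≈ j · y ∙ i · x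
  ·-commute₂ xy≈yx i j = ·-commute (≈-sym (·-commute (≈-sym xy≈yx) i)) j

  interchange : ∀ a b c d → b ∙ c ≈ c ∙ b → (a ∙ b) ∙ (c ∙ d) ≈ (a ∙ c) ∙ (b ∙ d)
  interchange a b c d bc≈cb = begin
    (a ∙ b) ∙ (c ∙ d)   ≈⟨ assoc a b (c ∙ d) ⟩
    a ∙ (b ∙ (c ∙ d))   ≈⟨ ∙-congˡ (assoc b c d) ⟨
    a ∙ ((b ∙ c) ∙ d)   ≈⟨ ∙-congˡ (∙-congʳ bc≈cb) ⟩
    a ∙ ((c ∙ b) ∙ d)   ≈⟨ ∙-congˡ (assoc c b d) ⟩
    a ∙ (c ∙ (b ∙ d))   ≈⟨ assoc a c (b ∙ d) ⟨
    (a ∙ c) ∙ (b ∙ d)   ∎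

consecutive-product-even : ∀ k → ∃ λ T → + k * (1ℤ + + k) ≡ + 2 * T
consecutive-product-even zero    = 0ℤ , refl
consecutive-product-even (suc k) with T , eq ← consecutive-product-even k =
  T + (1ℤ + + k) , trans (step (+ k)) (trans (cong (_+ + 2 * (1ℤ + + k)) eq) (sym (ℤP.*-distribˡ-+ (+ 2) T (1ℤ + + k))))
  where
  step : ∀ k → (1ℤ + k) * (1ℤ + (1ℤ + k)) ≡ k * (1ℤ + k) + + 2 * (1ℤ + k)
  step = solve-∀

private
  Λ-quotient : (k l j X₁ X₂ a b α β m′ n′ d T : ℤ) → ℤ
  Λ-quotient k l j X₁ X₂ a b α β m′ n′ d T =
    - (k * l * X₁ * X₂) - k * X₁ * b * n′ - a * m′ * l * X₂ + a * b * m′ * n′ * d + (1ℤ + d) * (k + l) * X₂ * α * m′ - T * α * β * m′ * n′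

  Λ-identity : ∀ k l j X₁ X₂ a b α β m′ n′ d T →
    + 2 * ((k * X₁ - a * (m′ * d)) * (l * X₂ - b * (n′ * d)))
      - (((- (1ℤ + d) * X₁ * X₂ * (l * l)) - (- (1ℤ + d) * X₁ * X₂ * (j * j))) + (- (1ℤ + d) * X₁ * X₂ * (k * k)))
    ≡ (- (k * l * X₁ * X₂) - k * X₁ * b * n′ - a * m′ * l * X₂ + a * b * m′ * n′ * d + (1ℤ + d) * (k + l) * X₂ * α * m′
         - T * α * β * m′ * n′) * (+ 2 * d)
      + ((+ 2 * (1ℤ + d) * (k + l) * X₂ - (1ℤ + d) * (k + l - j) * X₂) * ((k + l - j) * X₁ - α * (m′ * d))
         + (- (1ℤ + d) * α * (m′ * d)) * ((k + l - j) * X₂ - β * (n′ * d))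
         + (- (α * β * m′ * n′ * d)) * (d * (1ℤ + d) - + 2 * T))
  Λ-identity = solve-∀

  vanishing : ∀ A₁ A₂ A₃ {r₁ r₂ r₃} x → r₁ ≡ 0ℤ → r₂ ≡ 0ℤ → r₃ ≡ 0ℤ → x + (A₁ * r₁ + A₂ * r₂ + A₃ * r₃) ≡ x
  vanishing A₁ A₂ A₃ x refl refl refl = identity A₁ A₂ A₃ x
    where
    identity : ∀ A₁ A₂ A₃ x → x + (A₁ * 0ℤ + A₂ * 0ℤ + A₃ * 0ℤ) ≡ x
    identity = solve-∀

-- The left-hand side is 2 ℓ₁(g) ℓ₂(h) − δ₁Γ(g, h) for g = kx, h = lx, g + h = jx in a cyclic subgroup
-- ⟨x⟩, where Γ(kx) = −(1 + d) X₁ X₂ k² and Xᵢ lifts the i-th coordinate of x. Modulo 2d the cross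
-- terms 2klX₁X₂ cancel, the terms in (k + l − j)Xᵢ vanish because (k + l − j)x = 0, and the factor
-- 1 + d makes the remaining (k + l − j)² term a multiple of 2d, as d(1 + d) is even.
Λ-divisible : ∀ {L₁ L₂ k l j X₁ X₂ a b α β m n m′ n′ d T} →
  L₁ ≡ k * X₁ - a * m → L₂ ≡ l * X₂ - b * n → m ≡ m′ * d → n ≡ n′ * d →
  (k + l - j) * X₁ ≡ α * m → (k + l - j) * X₂ ≡ β * n → d * (1ℤ + d) ≡ + 2 * T →
  ∃ λ Q → + 2 * (L₁ * L₂) - (((- (1ℤ + d) * X₁ * X₂ * (l * l)) - (- (1ℤ + d) * X₁ * X₂ * (j * j))) + (- (1ℤ + d) * X₁ * X₂ * (k * k)))
          ≡ Q * (+ 2 * d)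
Λ-divisible {k = k} {l} {j} {X₁} {X₂} {a} {b} {α} {β} {m′ = m′} {n′} {d} {T} refl refl refl refl r₁ r₂ r₃ =
  Q , trans (Λ-identity k l j X₁ X₂ a b α β m′ n′ d T)
            (vanishing (+ 2 * (1ℤ + d) * (k + l) * X₂ - (1ℤ + d) * (k + l - j) * X₂) (- (1ℤ + d) * α * (m′ * d))
                       (- (α * β * m′ * n′ * d)) (Q * (+ 2 * d)) (ℤP.i≡j⇒i-j≡0 r₁) (ℤP.i≡j⇒i-j≡0 r₂) (ℤP.i≡j⇒i-j≡0 r₃))
  where Q = Λ-quotient k l j X₁ X₂ a b α β m′ n′ d T

module _ (m n : ℕ) .{{_ : NonZero m}} .{{_ : NonZero n}} where

  open CohomologyOf m n
  open IntegralCochains _+G_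

  private
    module C₁ = ℤmod m
    module C₂ = ℤmod n

  +G-comm : ∀ g h → g +G h ≡ h +G g
  +G-comm (a , b) (c , d) = ×-≡,≡→≡ (C₁.⊕-comm a c , C₂.⊕-comm b d)

  +G-assoc : ∀ g h k → (g +G h) +G k ≡ g +G (h +G k)
  +G-assoc (a , b) (c , d) (e , f) = ×-≡,≡→≡ (C₁.⊕-assoc a c e , C₂.⊕-assoc b d f)

  +G-identityˡ : ∀ g → 0G +G g ≡ g
  +G-identityˡ (a , b) = ×-≡,≡→≡ (C₁.⊕-identityˡ a , C₂.⊕-identityˡ b)

  +G-identityʳ : ∀ g → g +G 0G ≡ g
  +G-identityʳ g = trans (+G-comm g 0G) (+G-identityˡ g)

  +G-inverseʳ : ∀ g → g +G -G g ≡ 0G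
  +G-inverseʳ (a , b) = ×-≡,≡→≡ (C₁.⊕-inverseʳ a , C₂.⊕-inverseʳ b)

  +G-inverseˡ : ∀ g → -G g +G g ≡ 0G
  +G-inverseˡ g = trans (+G-comm (-G g) g) (+G-inverseʳ g)

  +G-isAbelianGroup : IsAbelianGroup _≡_ _+G_ 0G -G_
  +G-isAbelianGroup = record
    { isGroup = record
      { isMonoid = record
        { isSemigroup = record
          { isMagma = record { isEquivalence = isEquivalence ; ∙-cong = cong₂ _+G_ }
          ; assoc = +G-assoc }
        ; identity = +G-identityˡ , +G-identityʳ }
      ; inverse = +G-inverseˡ , +G-inverseʳ
      ; ⁻¹-cong = cong -G_ }
    ; comm = +G-comm }

  G-abelianGroup : AbelianGroup _ _
  G-abelianGroup = record { isAbelianGroup = +G-isAbelianGroup }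

  open import Algebra.Properties.AbelianGroup G-abelianGroup
    using (⁻¹-involutive; ⁻¹-∙-comm; inverseʳ-unique)

  infix 4 _≟G_
  _≟G_ : (g h : G) → Dec (g ≡ h)
  _≟G_ = ≡-dec Finₚ._≟_ Finₚ._≟_

  ·G-coordinates : ∀ k x → k ·G x ≡ (k C₁.⊙ proj₁ x , k C₂.⊙ proj₂ x)
  ·G-coordinates zero    x = refl
  ·G-coordinates (suc k) x = begin
    x +G k ·G x                                            ≡⟨ cong (x +G_) (·G-coordinates k x) ⟩
    (proj₁ x C₁.⊕ k C₁.⊙ proj₁ x , proj₂ x C₂.⊕ k C₂.⊙ proj₂ x) ≡⟨ ×-≡,≡→≡ (C₁.⊙-suc k (proj₁ x) , C₂.⊙-suc k (proj₂ x)) ⟨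
    (suc k C₁.⊙ proj₁ x , suc k C₂.⊙ proj₂ x)              ∎
    where open ≡-Reasoning

  ·G-homo-+ : ∀ a b x → (a ℕ.+ b) ·G x ≡ a ·G x +G b ·G x
  ·G-homo-+ zero    b x = sym (+G-identityˡ (b ·G x))
  ·G-homo-+ (suc a) b x = trans (cong (x +G_) (·G-homo-+ a b x)) (sym (+G-assoc x (a ·G x) (b ·G x)))

  N : ℕ
  N = m ℕ.* n

  instance
    N≢0 : NonZero N
    N≢0 = ℕP.m*n≢0 m n

  N·x≡0 : ∀ q x → (q ℕ.* N) ·G x ≡ 0G
  N·x≡0 q x = trans (·G-coordinates (q ℕ.* N) x) (×-≡,≡→≡
    ( trans (cong (C₁._⊙ proj₁ x) qmn≡[qn]m) (C₁.⊙-multiple (q ℕ.* n) (proj₁ x))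
    , trans (cong (C₂._⊙ proj₂ x) (sym (ℕP.*-assoc q m n))) (C₂.⊙-multiple (q ℕ.* m) (proj₂ x)) ))
    where
    qmn≡[qn]m : q ℕ.* N ≡ q ℕ.* n ℕ.* m
    qmn≡[qn]m = trans (cong (q ℕ.*_) (ℕP.*-comm m n)) (sym (ℕP.*-assoc q n m))

  e₁ e₂ : G
  e₁ = C₁.𝟙 , C₂.𝟘
  e₂ = C₁.𝟘 , C₂.𝟙

  m·e₁≡0 : m ·G e₁ ≡ 0G
  m·e₁≡0 = trans (·G-coordinates m e₁) (×-≡,≡→≡
    (trans (cong (C₁._⊙ C₁.𝟙) (sym (ℕP.*-identityˡ m))) (C₁.⊙-multiple 1 C₁.𝟙) , C₂.⊙-𝟘 m))

  n·e₂≡0 : n ·G e₂ ≡ 0G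
  n·e₂≡0 = trans (·G-coordinates n e₂) (×-≡,≡→≡
    (C₁.⊙-𝟘 n , trans (cong (C₂._⊙ C₂.𝟙) (sym (ℕP.*-identityˡ n))) (C₂.⊙-multiple 1 C₂.𝟙)))

  e-decomposition : ∀ g → toℕ (proj₁ g) ·G e₁ +G toℕ (proj₂ g) ·G e₂ ≡ g
  e-decomposition (a , b) = begin
    toℕ a ·G e₁ +G toℕ b ·G e₂   ≡⟨ cong₂ _+G_ (·G-coordinates (toℕ a) e₁) (·G-coordinates (toℕ b) e₂) ⟩
    (toℕ a C₁.⊙ C₁.𝟙 , toℕ a C₂.⊙ C₂.𝟘) +G (toℕ b C₁.⊙ C₁.𝟘 , toℕ b C₂.⊙ C₂.𝟙)
       ≡⟨ cong₂ _+G_ (×-≡,≡→≡ (C₁.⊙-one a , C₂.⊙-𝟘 (toℕ a))) (×-≡,≡→≡ (C₁.⊙-𝟘 (toℕ b) , C₂.⊙-one b)) ⟩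
    (a , C₂.𝟘) +G (C₁.𝟘 , b)     ≡⟨ ×-≡,≡→≡ (trans (C₁.⊕-comm a C₁.𝟘) (C₁.⊕-identityˡ a) , C₂.⊕-identityˡ b) ⟩
    (a , b)                      ∎
    where open ≡-Reasoning

  private
    y-g-h≡y-[g+h] : ∀ y g h → (y +G -G g) +G -G h ≡ y +G -G (g +G h)
    y-g-h≡y-[g+h] y g h = trans (+G-assoc y (-G g) (-G h)) (cong (y +G_) (⁻¹-∙-comm g h))

  -G[y-g]≡-Gy+g : ∀ y g → -G (y +G -G g) ≡ -G y +G g
  -G[y-g]≡-Gy+g y g = trans (sym (⁻¹-∙-comm y (-G g))) (cong (-G y +G_) (⁻¹-involutive g))

  δ²∘δ¹≡0 : ∀ ψ g h k y → δ² (δ¹ ψ) g h k y ≡ 0ℤ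
  δ²∘δ¹≡0 ψ g h k y rewrite y-g-h≡y-[g+h] y g h | +G-assoc g h k =
    δδ-identity₂ (ψ k (y +G -G (g +G h))) (ψ (h +G k) (y +G -G g)) (ψ h (y +G -G g))
                 (ψ (g +G (h +G k)) y) (ψ (g +G h) y) (ψ g y)

  δ³ : (G → G → G → ZG) → G → G → G → G → ZG
  δ³ Φ g h k l = (((act g (Φ h k l) -Z Φ (g +G h) k l) +Z Φ g (h +G k) l) -Z Φ g h (k +G l)) +Z Φ g h k

  δ³∘δ²≡0 : ∀ φ g h k l y → δ³ (δ² φ) g h k l y ≡ 0ℤ
  δ³∘δ²≡0 φ g h k l y rewrite y-g-h≡y-[g+h] y g h | +G-assoc g h k | +G-assoc h k l =
    δδ-identity₃ (φ k l (y +G -G (g +G h))) (φ (h +G k) l (y +G -G g)) (φ h (k +G l) (y +G -G g))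
                 (φ h k (y +G -G g)) (φ (g +G (h +G k)) l y) (φ (g +G h) (k +G l) y) (φ (g +G h) k y)
                 (φ g (h +G (k +G l)) y) (φ g (h +G k) y) (φ g h y)

  δ²-+ : ∀ φ φ′ g h k y → δ² (φ +C φ′) g h k y ≡ δ² φ g h k y + δ² φ′ g h k y
  δ²-+ φ φ′ g h k y = alternating-+ (φ h k (y +G -G g)) (φ (g +G h) k y) (φ g (h +G k) y) (φ g h y)
                                   (φ′ h k (y +G -G g)) (φ′ (g +G h) k y) (φ′ g (h +G k) y) (φ′ g h y)

  δ²-- : ∀ φ φ′ g h k y → δ² (φ -C φ′) g h k y ≡ δ² φ g h k y - δ² φ′ g h k y
  δ²-- φ φ′ g h k y = alternating-- (φ h k (y +G -G g)) (φ (g +G h) k y) (φ g (h +G k) y) (φ g h y)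
                                   (φ′ h k (y +G -G g)) (φ′ (g +G h) k y) (φ′ g (h +G k) y) (φ′ g h y)

  δ²-shift : ∀ (φ ψ : C²) (b : G → G → ℤ) → (∀ g h y → φ g h y ≡ ψ g h y + b g h) →
             ∀ g h k y → δ² φ g h k y ≡ δ² ψ g h k y + δ₂ b g h k
  δ²-shift φ ψ b φ≡ψ+b g h k y
    rewrite φ≡ψ+b h k (y +G -G g) | φ≡ψ+b (g +G h) k y | φ≡ψ+b g (h +G k) y | φ≡ψ+b g h y =
    alternating-+ (ψ h k (y +G -G g)) (ψ (g +G h) k y) (ψ g (h +G k) y) (ψ g h y) (b h k) (b (g +G h) k) (b g (h +G k)) (b g h)

  -- For a cocycle φ, δ² φ g h k is a constant function; its value is the image of [φ] under the
  -- connecting map H²(G, J_G) → H³(G, ℤ).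
  obstruction : C² → G → G → G → ℤ
  obstruction φ g h k = δ² φ g h k 0G

  cocycle⇒δ²-constant : ∀ φ → Is2Cocycle φ → ∀ g h k y → δ² φ g h k y ≡ obstruction φ g h k
  cocycle⇒δ²-constant φ φ-cocycle g h k y with c , δ²φ≡c ← φ-cocycle g h k = trans (δ²φ≡c y) (sym (δ²φ≡c 0G))

  obstruction-cocycle : ∀ φ → Is2Cocycle φ → ∀ g h k l → δ₃ (obstruction φ) g h k l ≡ 0ℤ
  obstruction-cocycle φ φ-cocycle g h k l =
    trans (cong (λ c → (((c - o (g +G h) k l) + o g (h +G k) l) - o g h (k +G l)) + o g h k)
                (sym (cocycle⇒δ²-constant φ φ-cocycle h k l (0G +G -G g))))
          (δ³∘δ²≡0 φ g h k l 0G)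
    where o = obstruction φ

  Is2Cocycle-- : ∀ φ φ′ → Is2Cocycle φ → Is2Cocycle φ′ → Is2Cocycle (φ -C φ′)
  Is2Cocycle-- φ φ′ φ-cocycle φ′-cocycle g h k = obstruction φ g h k - obstruction φ′ g h k , λ y → begin
    δ² (φ -C φ′) g h k y                              ≡⟨ δ²-- φ φ′ g h k y ⟩
    δ² φ g h k y - δ² φ′ g h k y                      ≡⟨ cong₂ _-_ (cocycle⇒δ²-constant φ φ-cocycle g h k y)
                                                                   (cocycle⇒δ²-constant φ′ φ′-cocycle g h k y) ⟩
    obstruction φ g h k - obstruction φ′ g h k        ≡⟨ ℤP.+-identityˡ _ ⟨
    0ℤ + (obstruction φ g h k - obstruction φ′ g h k) ∎
    where open ≡-Reasoning

  -- The inverse of the connecting map: an integral 3-cocycle c gives the J_G-cocycle (g, h) ↦ Σ_y c(−y, g, h)·y.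
  realisation : (G → G → G → ℤ) → C²
  realisation c g h y = c (-G y) g h

  private
    realisation-identity : ∀ a b e f c → ((a - b) + e) - f ≡ c - ((((c - a) + b) - e) + f)
    realisation-identity = solve-∀

  δ²-realisation : ∀ c → (∀ g h k l → δ₃ c g h k l ≡ 0ℤ) → ∀ g h k y → δ² (realisation c) g h k y ≡ c g h k
  δ²-realisation c δ₃c≡0 g h k y = begin
    ((c (-G (y +G -G g)) h k - b) + e) - f   ≡⟨ cong (λ u → ((c u h k - b) + e) - f) (-G[y-g]≡-Gy+g y g) ⟩
    ((c (-G y +G g) h k - b) + e) - f        ≡⟨ realisation-identity (c (-G y +G g) h k) b e f (c g h k) ⟩
    c g h k - δ₃ c (-G y) g h k              ≡⟨ cong (λ x → c g h k - x) (δ₃c≡0 (-G y) g h k) ⟩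
    c g h k - 0ℤ                             ≡⟨ ℤP.+-identityʳ (c g h k) ⟩
    c g h k                                  ∎
    where
    open ≡-Reasoning
    b = c (-G y) (g +G h) k
    e = c (-G y) g (h +G k)
    f = c (-G y) g h

  realisation-cocycle : ∀ c → (∀ g h k l → δ₃ c g h k l ≡ 0ℤ) → Is2Cocycle (realisation c)
  realisation-cocycle c δ₃c≡0 g h k = c g h k , λ y → trans (δ²-realisation c δ₃c≡0 g h k y) (sym (ℤP.+-identityˡ _))

  private
    add-sub-cancel : ∀ a b → a ≡ (a - b) + b
    add-sub-cancel = solve-∀

    shift-cancel : ∀ x y → x + y ≡ y → x ≡ 0ℤ
    shift-cancel x y eq = begin
      x             ≡⟨ identity x y ⟩
      (x + y) - y   ≡⟨ cong (_- y) eq ⟩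
      y - y         ≡⟨ ℤP.+-inverseʳ y ⟩
      0ℤ            ∎
      where
      open ≡-Reasoning
      identity : ∀ x y → x ≡ (x + y) - y
      identity = solve-∀

    solve-for-first : ∀ t a b c → ((t - a) + b) - c ≡ 0ℤ → t ≡ (a - b) + c
    solve-for-first t a b c eq = begin
      t                                  ≡⟨ identity t a b c ⟩
      (a - b) + c + (((t - a) + b) - c)  ≡⟨ cong (λ x → (a - b) + c + x) eq ⟩
      (a - b) + c + 0ℤ                   ≡⟨ ℤP.+-identityʳ _ ⟩
      (a - b) + c                        ∎
      where
      open ≡-Reasoning
      identity : ∀ t a b c → t ≡ (a - b) + c + (((t - a) + b) - c)
      identity = solve-∀

  -- ℤ[G] is induced from the trivial subgroup, so relative to a subgroup S with a transversal
  -- (y ↦ y + τ y picks one point in each coset y + S) a cochain with integral δ² is a coboundary on S;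
  -- ψ below is the usual contracting homotopy.
  module _ (S : G → Set) (S-+ : ∀ {g h} → S g → S h → S (g +G h))
           (τ : G → G) (τ∈S : ∀ y → S (τ y)) (τ-shift : ∀ {g} → S g → ∀ y → τ (y +G -G g) ≡ τ y +G g) where

    integral-obstruction⇒coboundaryOn : ∀ θ (b : G → G → ℤ) →
      (∀ {g h k} → S g → S h → S k → ∀ y → δ² θ g h k y ≡ δ₂ b g h k) → IsCoboundaryOn S θ
    integral-obstruction⇒coboundaryOn θ b δ²θ≡δ₂b = ψ , λ g h Sg Sh → b g h , θ≡δ¹ψ+b Sg Sh
      where
      θ′ : C²
      θ′ g h y = θ g h y - b g h

      δ²θ′≡0 : ∀ {g h k} → S g → S h → S k → ∀ y → δ² θ′ g h k y ≡ 0ℤ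
      δ²θ′≡0 {g} {h} {k} Sg Sh Sk y = shift-cancel (δ² θ′ g h k y) (δ₂ b g h k) (begin
        δ² θ′ g h k y + δ₂ b g h k  ≡⟨ δ²-shift θ θ′ b (λ g h y → add-sub-cancel (θ g h y) (b g h)) g h k y ⟨
        δ² θ g h k y                ≡⟨ δ²θ≡δ₂b Sg Sh Sk y ⟩
        δ₂ b g h k                  ∎)
        where open ≡-Reasoning

      ψ : C¹
      ψ g y = θ′ (τ y) g (y +G τ y)

      θ≡δ¹ψ+b : ∀ {g h} → S g → S h → ∀ y → θ g h y ≡ δ¹ ψ g h y + b g h
      θ≡δ¹ψ+b {g} {h} Sg Sh y = begin
        θ g h y                                                  ≡⟨ add-sub-cancel (θ g h y) (b g h) ⟩
        θ′ g h y + b g h                                         ≡⟨ cong (_+ b g h) θ′≡ ⟩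
        (θ′ (a +G g) h z - θ′ a (g +G h) z) + θ′ a g z + b g h  ≡⟨ cong (λ u → (u - θ′ a (g +G h) z) + θ′ a g z + b g h) ψ-shift ⟨
        δ¹ ψ g h y + b g h                                       ∎
        where
        open ≡-Reasoning
        a = τ y
        z = y +G a
        z-a≡y : z +G -G a ≡ y
        z-a≡y = trans (+G-assoc y a (-G a)) (trans (cong (y +G_) (+G-inverseʳ a)) (+G-identityʳ y))
        ψ-shift : ψ h (y +G -G g) ≡ θ′ (a +G g) h z
        ψ-shift rewrite τ-shift Sg y = cong (θ′ (a +G g) h) (begin
          (y +G -G g) +G (a +G g)  ≡⟨ +G-assoc y (-G g) (a +G g) ⟩
          y +G (-G g +G (a +G g))  ≡⟨ cong (y +G_) (trans (+G-comm (-G g) (a +G g)) (trans (+G-assoc a g (-G g))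
                                        (trans (cong (a +G_) (+G-inverseʳ g)) (+G-identityʳ a)))) ⟩
          z                        ∎)
        θ′≡ : θ′ g h y ≡ (θ′ (a +G g) h z - θ′ a (g +G h) z) + θ′ a g z
        θ′≡ = solve-for-first (θ′ g h y) (θ′ (a +G g) h z) (θ′ a (g +G h) z) (θ′ a g z)
                (trans (cong (λ u → ((θ′ g h u - θ′ (a +G g) h z) + θ′ a (g +G h) z) - θ′ a g z) (sym z-a≡y))
                       (δ²θ′≡0 (τ∈S y) Sg Sh z))

  integral-obstruction⇒coboundary : ∀ θ (b : G → G → ℤ) →
    (∀ g h k y → δ² θ g h k y ≡ δ₂ b g h k) → Is2Coboundary θ
  integral-obstruction⇒coboundary θ b δ²θ≡δ₂b =
    integral-obstruction⇒coboundaryOn (λ _ → ⊤) _ -G_ _ (λ {g} _ y → -G[y-g]≡-Gy+g y g) θ b (λ _ _ _ → δ²θ≡δ₂b _ _ _)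

  open FiniteSum (*↔× {m} {n})

  translation : G → G ↔ G
  translation g = mk↔ₛ′ (_+G g) (_+G -G g) (cancel (-G g) g (+G-inverseˡ g)) (cancel g (-G g) (+G-inverseʳ g))
    where
    cancel : ∀ a b → a +G b ≡ 0G → ∀ x → (x +G a) +G b ≡ x
    cancel a b a+b≡0 x = trans (+G-assoc x a b) (trans (cong (x +G_) a+b≡0) (+G-identityʳ x))

  ∑-translate : ∀ f g → ∑ (λ x → f (x +G g)) ≡ ∑ f
  ∑-translate f g = ∑-bijection (translation g) f

  ∑-linear : ∀ a b c e → ∑ (λ x → ((a x - b x) + c x) - e x) ≡ ((∑ a - ∑ b) + ∑ c) - ∑ e
  ∑-linear a b c e = begin
    ∑ (λ x → ((a x - b x) + c x) - e x)   ≡⟨ ∑-- (λ x → (a x - b x) + c x) e ⟩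
    ∑ (λ x → (a x - b x) + c x) - ∑ e     ≡⟨ cong (_- ∑ e) (∑-+ (λ x → a x - b x) c) ⟩
    (∑ (λ x → a x - b x) + ∑ c) - ∑ e     ≡⟨ cong (λ s → (s + ∑ c) - ∑ e) (∑-- a b) ⟩
    ((∑ a - ∑ b) + ∑ c) - ∑ e             ∎
    where open ≡-Reasoning

  ∑₁ : (G → G → G → ℤ) → G → G → ℤ
  ∑₁ c g h = ∑ (λ x → c x g h)

  private
    δ₂-rearrangement : ∀ a b c e → ((a - b) + c) - e ≡ a - ((b - c) + e)
    δ₂-rearrangement = solve-∀

    δ₃-rearrangement : ∀ a b c e f → (((a - b) + c) - e) + f ≡ a - (((b - c) + e) - f)
    δ₃-rearrangement = solve-∀

  ∑₁∘δ₂ : ∀ f g h → ∑₁ (δ₂ f) g h ≡ + N * f g h - δ₁ (λ h → ∑ (λ x → f x h)) g h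
  ∑₁∘δ₂ f g h = begin
    ∑₁ (δ₂ f) g h                                           ≡⟨ ∑-linear (λ _ → f g h) (λ x → f (x +G g) h) (λ x → f x (g +G h)) (λ x → f x g) ⟩
    ((∑ (λ _ → f g h) - ∑ (λ x → f (x +G g) h)) + F (g +G h)) - F g
                                                            ≡⟨ cong₂ (λ s t → ((s - t) + F (g +G h)) - F g) (∑-const (f g h)) (∑-translate (λ x → f x h) g) ⟩
    ((+ N * f g h - F h) + F (g +G h)) - F g                ≡⟨ δ₂-rearrangement (+ N * f g h) (F h) (F (g +G h)) (F g) ⟩
    + N * f g h - δ₁ F g h                                  ∎
    where
    open ≡-Reasoning
    F : G → ℤ
    F h = ∑ (λ x → f x h)

  δ₂∘∑₁ : ∀ c → (∀ g h k l → δ₃ c g h k l ≡ 0ℤ) → ∀ g h k → δ₂ (∑₁ c) g h k ≡ + N * c g h k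
  δ₂∘∑₁ c δ₃c≡0 g h k = sym (ℤP.i-j≡0⇒i≡j (+ N * c g h k) (δ₂ B g h k) (begin
    + N * c g h k - δ₂ B g h k                                                   ≡⟨ δ₃-rearrangement (+ N * c g h k) (B h k) (B (g +G h) k) (B g (h +G k)) (B g h) ⟨
    (((+ N * c g h k - B h k) + B (g +G h) k) - B g (h +G k)) + B g h            ≡⟨ cong (λ s → (((s - B h k) + B (g +G h) k) - B g (h +G k)) + B g h) (∑-const (c g h k)) ⟨
    (((∑ (λ _ → c g h k) - B h k) + B (g +G h) k) - B g (h +G k)) + B g h        ≡⟨ cong (λ s → (((∑ (λ _ → c g h k) - s) + B (g +G h) k) - B g (h +G k)) + B g h)
                                                                                        (∑-translate (λ x → c x h k) g) ⟨
    (((∑ (λ _ → c g h k) - ∑ (λ x → c (x +G g) h k)) + B (g +G h) k) - B g (h +G k)) + B g h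
                                                                                 ≡⟨ cong (_+ B g h) (∑-linear (λ _ → c g h k) (λ x → c (x +G g) h k) (λ x → c x (g +G h) k) (λ x → c x g (h +G k))) ⟨
    ∑ (λ x → ((c g h k - c (x +G g) h k) + c x (g +G h) k) - c x g (h +G k)) + B g h
                                                                                 ≡⟨ ∑-+ (λ x → ((c g h k - c (x +G g) h k) + c x (g +G h) k) - c x g (h +G k)) (λ x → c x g h) ⟨
    ∑ (λ x → δ₃ c x g h k)                                                       ≡⟨ ∑-cong (λ x → δ₃c≡0 x g h k) ⟩
    ∑ (λ _ → 0ℤ)                                                                 ≡⟨ ∑-const 0ℤ ⟩
    + N * 0ℤ                                                                     ≡⟨ ℤP.*-zeroʳ (+ N) ⟩
    0ℤ                                                                           ∎))
    where
    open ≡-Reasoning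
    B = ∑₁ c

  commutator : (G → G → ℤ) → G → G → ℤ
  commutator B g h = B g h - B h g

  private
    -- ω(g + h, k) − ω(g, k) − ω(h, k) = −δ₂B(g, h, k) + δ₂B(g, k, h) − δ₂B(k, g, h) for commutative G.
    bilinearity-identity : ∀ A A′ P P′ Q Q′ R S T →
      A - A′ ≡ ((P - P′) + (Q - Q′)) + ((- (((Q - A) + R) - T) + (((Q′ - S) + R) - P)) - (((T - S) + A′) - P′))
    bilinearity-identity = solve-∀

    bilinearity-quotient : ∀ K a b c → (- (K * a) + K * b) - K * c ≡ ((- a + b) - c) * K
    bilinearity-quotient = solve-∀

    normalisation-identity : ∀ A A′ C → A - A′ ≡ (((A - A) + A) - C) + (((C - A′) + A′) - A′)
    normalisation-identity = solve-∀

    normalisation-quotient : ∀ K a b → K * a + K * b ≡ 0ℤ + (a + b) * K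
    normalisation-quotient = solve-∀

    antisymmetry-identity : ∀ k a b → k * (a - b) ≡ -1ℤ * (k * (b - a))
    antisymmetry-identity = solve-∀

  -- When δ₂ B = K·c, B is a 2-cocycle modulo K and ω is the commutator pairing of the central
  -- extension it defines; the pairing is bilinear modulo K.
  module _ {K : ℕ} (B : G → G → ℤ) (c : G → G → G → ℤ) (δ₂B≡Kc : ∀ g h k → δ₂ B g h k ≡ + K * c g h k) where

    private
      ω = commutator B

    commutator-+ : ∀ g h k → ω (g +G h) k ≡ ω g k + ω h k ⟨mod K ⟩
    commutator-+ g h k = (- c g h k + c g k h) - c k g h , (begin
      ω (g +G h) k
        ≡⟨ bilinearity-identity (B (g +G h) k) (B k (g +G h)) (B g k) (B k g) (B h k) (B k h) (B g (h +G k)) (B (k +G g) h) (B g h) ⟩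
      (ω g k + ω h k) + ((- δ₂ B g h k + (((B k h - B (k +G g) h) + B g (h +G k)) - B g k)) - δ₂ B k g h)
        ≡⟨ cong (λ x → (ω g k + ω h k) + ((- δ₂ B g h k + x) - δ₂ B k g h))
                (cong₂ (λ u v → ((B k h - B u h) + B g v) - B g k) (+G-comm g k) (+G-comm k h)) ⟨
      (ω g k + ω h k) + ((- δ₂ B g h k + δ₂ B g k h) - δ₂ B k g h)
        ≡⟨ cong (λ x → (ω g k + ω h k) + x) (cong₂ _-_ (cong₂ _+_ (cong -_ (δ₂B≡Kc g h k)) (δ₂B≡Kc g k h)) (δ₂B≡Kc k g h)) ⟩
      (ω g k + ω h k) + ((- (+ K * c g h k) + + K * c g k h) - + K * c k g h)
        ≡⟨ cong (λ x → (ω g k + ω h k) + x) (bilinearity-quotient (+ K) (c g h k) (c g k h) (c k g h)) ⟩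
      (ω g k + ω h k) + ((- c g h k + c g k h) - c k g h) * + K ∎)
      where open ≡-Reasoning

    commutator-0 : ∀ y → ω 0G y ≡ 0ℤ ⟨mod K ⟩
    commutator-0 y = c 0G 0G y + c y 0G 0G , (begin
      ω 0G y
        ≡⟨ normalisation-identity (B 0G y) (B y 0G) (B 0G 0G) ⟩
      (((B 0G y - B 0G y) + B 0G y) - B 0G 0G) + (((B 0G 0G - B y 0G) + B y 0G) - B y 0G)
        ≡⟨ cong₂ _+_ (cong₂ (λ u v → ((B 0G y - B u y) + B 0G v) - B 0G 0G) (+G-identityˡ 0G) (+G-identityˡ y))
                     (cong₂ (λ u v → ((B 0G 0G - B u 0G) + B y v) - B y 0G) (+G-identityʳ y) (+G-identityˡ 0G)) ⟨
      δ₂ B 0G 0G y + δ₂ B y 0G 0G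
        ≡⟨ cong₂ _+_ (δ₂B≡Kc 0G 0G y) (δ₂B≡Kc y 0G 0G) ⟩
      + K * c 0G 0G y + + K * c y 0G 0G
        ≡⟨ normalisation-quotient (+ K) (c 0G 0G y) (c y 0G 0G) ⟩
      0ℤ + (c 0G 0G y + c y 0G 0G) * + K ∎)
      where open ≡-Reasoning

    commutator-·G : ∀ j x y → ω (j ·G x) y ≡ + j * ω x y ⟨mod K ⟩
    commutator-·G zero    x y = ⟨mod⟩-trans (commutator-0 y) (⟨mod⟩-reflexive (sym (ℤP.*-zeroˡ (ω x y))))
    commutator-·G (suc j) x y = begin
      ω (x +G j ·G x) y       ≈⟨ commutator-+ x (j ·G x) y ⟩
      ω x y + ω (j ·G x) y    ≈⟨ ⟨mod⟩-+ (⟨mod⟩-refl {a = ω x y}) (commutator-·G j x y) ⟩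
      ω x y + + j * ω x y     ≡⟨ ℤP.suc-* (+ j) (ω x y) ⟨
      + suc j * ω x y         ∎
      where open ⟨mod⟩-Reasoning K

    m·commutator≡0 : + m * ω e₁ e₂ ≡ 0ℤ ⟨mod K ⟩
    m·commutator≡0 = begin
      + m * ω e₁ e₂     ≈⟨ commutator-·G m e₁ e₂ ⟨
      ω (m ·G e₁) e₂    ≡⟨ cong (λ g → ω g e₂) m·e₁≡0 ⟩
      ω 0G e₂           ≈⟨ commutator-0 e₂ ⟩
      0ℤ                ∎
      where open ⟨mod⟩-Reasoning K

    n·commutator≡0 : + n * ω e₁ e₂ ≡ 0ℤ ⟨mod K ⟩
    n·commutator≡0 = begin
      + n * ω e₁ e₂              ≡⟨ antisymmetry-identity (+ n) (B e₁ e₂) (B e₂ e₁) ⟩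
      -1ℤ * (+ n * ω e₂ e₁)      ≈⟨ ⟨mod⟩-*ˡ -1ℤ (commutator-·G n e₂ e₁) ⟨
      -1ℤ * ω (n ·G e₂) e₁       ≡⟨ cong (λ g → -1ℤ * ω g e₁) n·e₂≡0 ⟩
      -1ℤ * ω 0G e₁              ≈⟨ ⟨mod⟩-*ˡ -1ℤ (commutator-0 e₁) ⟩
      -1ℤ * 0ℤ                   ≡⟨⟩
      0ℤ                         ∎
      where open ⟨mod⟩-Reasoning K

  ℓ₁ ℓ₂ : G → ℤ
  ℓ₁ g = C₁.lift (proj₁ g)
  ℓ₂ g = C₂.lift (proj₂ g)

  κ₁ κ₂ : G → G → ℤ
  κ₁ g h = C₁.carry (proj₁ g) (proj₁ h)
  κ₂ g h = C₂.carry (proj₂ g) (proj₂ h)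

  δ₁ℓ₁≡m*κ₁ : ∀ g h → δ₁ ℓ₁ g h ≡ + m * κ₁ g h
  δ₁ℓ₁≡m*κ₁ g h = C₁.lift-carry (proj₁ g) (proj₁ h)

  δ₁ℓ₂≡n*κ₂ : ∀ g h → δ₁ ℓ₂ g h ≡ + n * κ₂ g h
  δ₁ℓ₂≡n*κ₂ g h = C₂.lift-carry (proj₂ g) (proj₂ h)

  δ₂κ₁≡0 : ∀ g h k → δ₂ κ₁ g h k ≡ 0ℤ
  δ₂κ₁≡0 = δ₁≡M*κ⇒δ₂κ≡0 +G-assoc m ℓ₁ κ₁ δ₁ℓ₁≡m*κ₁

  δ₂κ₂≡0 : ∀ g h k → δ₂ κ₂ g h k ≡ 0ℤ
  δ₂κ₂≡0 = δ₁≡M*κ⇒δ₂κ≡0 +G-assoc n ℓ₂ κ₂ δ₁ℓ₂≡n*κ₂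

  module Extension {K : ℕ} (B : G → G → ℤ) (c : G → G → G → ℤ) (δ₂B≡Kc : ∀ g h k → δ₂ B g h k ≡ + K * c g h k) where

    β : G → G → ℤ
    β g h = B g h - B 0G 0G

    private
      shift-identity : ∀ a b c e x → ((((a - x) - (b - x)) + (c - x)) - (e - x)) ≡ ((a - b) + c) - e
      shift-identity = solve-∀

    δ₂β≡0 : ∀ g h k → δ₂ β g h k ≡ 0ℤ ⟨mod K ⟩
    δ₂β≡0 g h k = c g h k , (begin
      δ₂ β g h k            ≡⟨ shift-identity (B h k) (B (g +G h) k) (B g (h +G k)) (B g h) (B 0G 0G) ⟩
      δ₂ B g h k            ≡⟨ δ₂B≡Kc g h k ⟩
      + K * c g h k         ≡⟨ ℤP.*-comm (+ K) (c g h k) ⟩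
      c g h k * + K         ≡⟨ ℤP.+-identityˡ _ ⟨
      0ℤ + c g h k * + K    ∎)
      where open ≡-Reasoning

    β00≡0 : β 0G 0G ≡ 0ℤ
    β00≡0 = ℤP.+-inverseʳ (B 0G 0G)

    private
      left-identity : ∀ x → ((x - x) + x) - 0ℤ ≡ x
      left-identity = solve-∀

      right-identity : ∀ x → ((0ℤ - x) + x) - x ≡ - x
      right-identity = solve-∀

    β0h≡0 : ∀ h → β 0G h ≡ 0ℤ ⟨mod K ⟩
    β0h≡0 h = begin
      β 0G h                                        ≡⟨ left-identity (β 0G h) ⟨
      ((β 0G h - β 0G h) + β 0G h) - 0ℤ             ≡⟨ cong (λ z → ((β 0G h - β 0G h) + β 0G h) - z) β00≡0 ⟨
      ((β 0G h - β 0G h) + β 0G h) - β 0G 0G        ≡⟨ cong₂ (λ u v → ((β 0G h - β u h) + β 0G v) - β 0G 0G) (+G-identityˡ 0G) (+G-identityˡ h) ⟨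
      δ₂ β 0G 0G h                                  ≈⟨ δ₂β≡0 0G 0G h ⟩
      0ℤ                                            ∎
      where open ⟨mod⟩-Reasoning K

    βg0≡0 : ∀ g → β g 0G ≡ 0ℤ ⟨mod K ⟩
    βg0≡0 g = begin
      β g 0G                                        ≡⟨ ℤP.neg-involutive (β g 0G) ⟨
      - (- β g 0G)                                  ≡⟨ cong -_ (right-identity (β g 0G)) ⟨
      - (((0ℤ - β g 0G) + β g 0G) - β g 0G)         ≡⟨ cong (λ z → - (((z - β g 0G) + β g 0G) - β g 0G)) β00≡0 ⟨
      - (((β 0G 0G - β g 0G) + β g 0G) - β g 0G)    ≡⟨ cong₂ (λ u v → - (((β 0G 0G - β u 0G) + β g v) - β g 0G)) (+G-identityʳ g) (+G-identityˡ 0G) ⟨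
      - δ₂ β g 0G 0G                                ≈⟨ ⟨mod⟩-neg (δ₂β≡0 g 0G 0G) ⟩
      - 0ℤ                                          ≡⟨⟩
      0ℤ                                            ∎
      where open ⟨mod⟩-Reasoning K

    -- ℤ × G with (a, g)(b, h) = (a + b + β(g, h), g + h), first components compared modulo K, is the
    -- central extension of G by ℤ/K defined by β. Without eta, u ∙ v does not unfold for variables
    -- u, v, so Agda can still infer them.
    record Ext : Set where
      no-eta-equality
      pattern
      constructor _,_
      field
        centre : ℤ
        image : G

    infix 4 _≈_
    _≈_ : Ext → Ext → Set
    (a , g) ≈ (b , h) = a ≡ b ⟨mod K ⟩ × g ≡ h

    infixl 7 _∙_
    _∙_ : Ext → Ext → Ext
    (a , g) ∙ (b , h) = a + b + β g h , g +G h

    ε : Ext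
    ε = 0ℤ , 0G

    private
      assoc-identity : ∀ a b c x y z w → a + b + x + c + y ≡ a + (b + c + z) + w - (((z - y) + w) - x)
      assoc-identity = solve-∀

    ∙-assoc : ∀ u v w → (u ∙ v) ∙ w ≈ u ∙ (v ∙ w)
    ∙-assoc (a , g) (b , h) (c , k) = first , +G-assoc g h k
      where
      open ⟨mod⟩-Reasoning K
      first : a + b + β g h + c + β (g +G h) k ≡ a + (b + c + β h k) + β g (h +G k) ⟨mod K ⟩
      first = begin
        a + b + β g h + c + β (g +G h) k                       ≡⟨ assoc-identity a b c (β g h) (β (g +G h) k) (β h k) (β g (h +G k)) ⟩
        a + (b + c + β h k) + β g (h +G k) - δ₂ β g h k        ≈⟨ ⟨mod⟩-+ˡ (a + (b + c + β h k) + β g (h +G k)) (⟨mod⟩-neg (δ₂β≡0 g h k)) ⟩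
        a + (b + c + β h k) + β g (h +G k) - 0ℤ                ≡⟨ ℤP.+-identityʳ _ ⟩
        a + (b + c + β h k) + β g (h +G k)                     ∎

    ∙-identityˡ : ∀ u → ε ∙ u ≈ u
    ∙-identityˡ (b , h) = first , +G-identityˡ h
      where
      open ⟨mod⟩-Reasoning K
      first : 0ℤ + b + β 0G h ≡ b ⟨mod K ⟩
      first = begin
        0ℤ + b + β 0G h  ≈⟨ ⟨mod⟩-+ˡ (0ℤ + b) (β0h≡0 h) ⟩
        0ℤ + b + 0ℤ      ≡⟨ trans (ℤP.+-identityʳ _) (ℤP.+-identityˡ b) ⟩
        b                ∎

    ∙-identityʳ : ∀ u → u ∙ ε ≈ u
    ∙-identityʳ (a , g) = first , +G-identityʳ g
      where
      open ⟨mod⟩-Reasoning K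
      first : a + 0ℤ + β g 0G ≡ a ⟨mod K ⟩
      first = begin
        a + 0ℤ + β g 0G  ≈⟨ ⟨mod⟩-+ˡ (a + 0ℤ) (βg0≡0 g) ⟩
        a + 0ℤ + 0ℤ      ≡⟨ trans (ℤP.+-identityʳ _) (ℤP.+-identityʳ a) ⟩
        a                ∎

    ∙-cong : ∀ {u u′ v v′} → u ≈ u′ → v ≈ v′ → u ∙ v ≈ u′ ∙ v′
    ∙-cong {_ , _} {_ , _} {_ , _} {_ , _} (a≡a′ , refl) (b≡b′ , refl) = ⟨mod⟩-+ (⟨mod⟩-+ a≡a′ b≡b′) ⟨mod⟩-refl , refl

    extension : Monoid _ _
    extension = record
      { Carrier = Ext ; _≈_ = _≈_ ; _∙_ = _∙_ ; ε = ε
      ; isMonoid = record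
        { isSemigroup = record
          { isMagma = record
            { isEquivalence = record
              { refl = λ { {_ , _} → ⟨mod⟩-refl , refl }
              ; sym = λ { {_ , _} {_ , _} (a≡b , g≡h) → ⟨mod⟩-sym a≡b , sym g≡h }
              ; trans = λ { {_ , _} {_ , _} {_ , _} (a≡b , g≡h) (b≡c , h≡k) → ⟨mod⟩-trans a≡b b≡c , trans g≡h h≡k } }
            ; ∙-cong = ∙-cong }
          ; assoc = ∙-assoc }
        ; identity = ∙-identityˡ , ∙-identityʳ } }

    open import Algebra.Properties.Monoid.Mult extension
      using (×-congʳ; ×-homo-+; ×-assocˡ) renaming (_×_ to _·E_)
    private
      module ≈-Reasoning = SetoidReasoning (Monoid.setoid extension)
    open Monoid extension using (∙-congˡ; ∙-congʳ) renaming (sym to ≈-sym; trans to ≈-trans)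
    open CommutingElements extension using (·-commute₂; interchange)

    image-·E : ∀ k a g → Ext.image (k ·E (a , g)) ≡ k ·G g
    image-·E zero    a g = refl
    image-·E (suc k) a g with k ·E (a , g) | image-·E k a g
    ... | b , h | refl = refl

    central : ∀ a u → (a , 0G) ∙ u ≈ u ∙ (a , 0G)
    central a (b , h) = first , trans (+G-identityˡ h) (sym (+G-identityʳ h))
      where
      first : a + b + β 0G h ≡ b + a + β h 0G ⟨mod K ⟩
      first = ⟨mod⟩-trans (⟨mod⟩-+ˡ (a + b) (β0h≡0 h))
                (⟨mod⟩-trans (⟨mod⟩-reflexive (cong (_+ 0ℤ) (ℤP.+-comm a b))) (⟨mod⟩-+ˡ (b + a) (⟨mod⟩-sym (βg0≡0 h))))

    central-∙ : ∀ a b → (a , 0G) ∙ (b , 0G) ≈ (a + b , 0G)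
    central-∙ a b = ⟨mod⟩-reflexive (trans (cong (λ x → a + b + x) β00≡0) (ℤP.+-identityʳ (a + b))) , +G-identityˡ 0G

    ·E-central : ∀ k a → k ·E (a , 0G) ≈ (+ k * a , 0G)
    ·E-central zero    a = ⟨mod⟩-reflexive (sym (ℤP.*-zeroˡ a)) , refl
    ·E-central (suc k) a = begin
      (a , 0G) ∙ k ·E (a , 0G)   ≈⟨ ∙-congˡ (·E-central k a) ⟩
      (a , 0G) ∙ (+ k * a , 0G)  ≈⟨ central-∙ a (+ k * a) ⟩
      (a + + k * a , 0G)         ≡⟨ cong (_, 0G) (ℤP.suc-* (+ k) a) ⟨
      (+ suc k * a , 0G)         ∎
      where open ≈-Reasoning

    ·E-reduce : ∀ M .{{_ : NonZero M}} u a → M ·E u ≈ (a , 0G) → ∀ i → i ·E u ≈ (i % M) ·E u ∙ (+ (i / M) * a , 0G)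
    ·E-reduce M u a Mu≈a i = begin
      i ·E u                                  ≡⟨ cong (_·E u) (m≡m%n+[m/n]*n i M) ⟩
      (i % M ℕ.+ i / M ℕ.* M) ·E u            ≈⟨ ×-homo-+ u (i % M) (i / M ℕ.* M) ⟩
      (i % M) ·E u ∙ (i / M ℕ.* M) ·E u       ≈⟨ ∙-congˡ (×-assocˡ u (i / M) M) ⟨
      (i % M) ·E u ∙ (i / M) ·E (M ·E u)      ≈⟨ ∙-congˡ (×-congʳ (i / M) Mu≈a) ⟩
      (i % M) ·E u ∙ (i / M) ·E (a , 0G)      ≈⟨ ∙-congˡ (·E-central (i / M) a) ⟩
      (i % M) ·E u ∙ (+ (i / M) * a , 0G)     ∎
      where open ≈-Reasoning

    ≈-η : ∀ u → u ≈ (Ext.centre u , Ext.image u)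
    ≈-η (a , g) = ⟨mod⟩-refl , refl

    ≈⇒centre : ∀ {u v} → u ≈ v → Ext.centre u ≡ Ext.centre v ⟨mod K ⟩
    ≈⇒centre {_ , _} {_ , _} (a≡b , _) = a≡b

    centre-∙ : ∀ u v → Ext.centre (u ∙ v) ≡ Ext.centre u + Ext.centre v + β (Ext.image u) (Ext.image v)
    centre-∙ (_ , _) (_ , _) = refl

    image-∙ : ∀ u v → Ext.image (u ∙ v) ≡ Ext.image u +G Ext.image v
    image-∙ (_ , _) (_ , _) = refl

    ê₁ ê₂ : Ext
    ê₁ = 0ℤ , e₁
    ê₂ = 0ℤ , e₂

    p q : ℤ
    p = Ext.centre (m ·E ê₁)
    q = Ext.centre (n ·E ê₂)

    m·ê₁≈p : m ·E ê₁ ≈ (p , 0G)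
    m·ê₁≈p = ≈-trans (≈-η (m ·E ê₁)) (⟨mod⟩-refl , trans (image-·E m 0ℤ e₁) m·e₁≡0)

    n·ê₂≈q : n ·E ê₂ ≈ (q , 0G)
    n·ê₂≈q = ≈-trans (≈-η (n ·E ê₂)) (⟨mod⟩-refl , trans (image-·E n 0ℤ e₂) n·e₂≡0)

    P : ℕ → ℕ → Ext
    P i j = i ·E ê₁ ∙ j ·E ê₂

    σ : G → Ext
    σ g = P (toℕ (proj₁ g)) (toℕ (proj₂ g))

    ρ : G → ℤ
    ρ g = Ext.centre (σ g)

    σ-image : ∀ g → Ext.image (σ g) ≡ g
    σ-image g = trans (image-∙ (toℕ (proj₁ g) ·E ê₁) (toℕ (proj₂ g) ·E ê₂))
                      (trans (cong₂ _+G_ (image-·E (toℕ (proj₁ g)) 0ℤ e₁) (image-·E (toℕ (proj₂ g)) 0ℤ e₂))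
                             (e-decomposition g))

    P-reduce : ∀ i j → P i j ≈ P (i % m) (j % n) ∙ (+ (i / m) * p + + (j / n) * q , 0G)
    P-reduce i j = begin
      i ·E ê₁ ∙ j ·E ê₂                 ≈⟨ ∙-cong (·E-reduce m ê₁ p m·ê₁≈p i) (·E-reduce n ê₂ q n·ê₂≈q j) ⟩
      (A₀ ∙ C₁) ∙ (B₀ ∙ C₂)             ≈⟨ interchange A₀ C₁ B₀ C₂ (central (+ (i / m) * p) B₀) ⟩
      (A₀ ∙ B₀) ∙ (C₁ ∙ C₂)             ≈⟨ ∙-congˡ (central-∙ (+ (i / m) * p) (+ (j / n) * q)) ⟩
      P (i % m) (j % n) ∙ (+ (i / m) * p + + (j / n) * q , 0G)  ∎
      where
      open ≈-Reasoning
      A₀ = (i % m) ·E ê₁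
      B₀ = (j % n) ·E ê₂
      C₁ = (+ (i / m) * p , 0G)
      C₂ = (+ (j / n) * q , 0G)

    -- If the lifts ê₁, ê₂ commute, the section σ is multiplicative up to central elements built from
    -- the carries, so B is cohomologous modulo K to a sum of carry cocycles.
    module _ (symmetric : B e₁ e₂ ≡ B e₂ e₁ ⟨mod K ⟩) where

      ê-commute : ê₁ ∙ ê₂ ≈ ê₂ ∙ ê₁
      ê-commute = ⟨mod⟩-+ˡ (0ℤ + 0ℤ) (⟨mod⟩-+ʳ (- B 0G 0G) symmetric) , +G-comm e₁ e₂

      P-∙ : ∀ i j i′ j′ → P i j ∙ P i′ j′ ≈ P (i ℕ.+ i′) (j ℕ.+ j′)
      P-∙ i j i′ j′ = begin
        (i ·E ê₁ ∙ j ·E ê₂) ∙ (i′ ·E ê₁ ∙ j′ ·E ê₂)   ≈⟨ interchange (i ·E ê₁) (j ·E ê₂) (i′ ·E ê₁) (j′ ·E ê₂) (≈-sym (·-commute₂ ê-commute i′ j)) ⟩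
        (i ·E ê₁ ∙ i′ ·E ê₁) ∙ (j ·E ê₂ ∙ j′ ·E ê₂)   ≈⟨ ∙-cong (×-homo-+ ê₁ i i′) (×-homo-+ ê₂ j j′) ⟨
        P (i ℕ.+ i′) (j ℕ.+ j′)                       ∎
        where open ≈-Reasoning

      σ-∙ : ∀ g h → σ g ∙ σ h ≈ σ (g +G h) ∙ (κ₁ g h * p + κ₂ g h * q , 0G)
      σ-∙ g h = begin
        σ g ∙ σ h                                        ≈⟨ P-∙ i j i′ j′ ⟩
        P (i ℕ.+ i′) (j ℕ.+ j′)                          ≈⟨ P-reduce (i ℕ.+ i′) (j ℕ.+ j′) ⟩
        P ((i ℕ.+ i′) % m) ((j ℕ.+ j′) % n) ∙ Y          ≡⟨ cong (_∙ Y) (cong₂ P (C₁.toℕ-mod (i ℕ.+ i′)) (C₂.toℕ-mod (j ℕ.+ j′))) ⟨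
        σ (g +G h) ∙ Y                                   ∎
        where
        open ≈-Reasoning
        i = toℕ (proj₁ g)
        j = toℕ (proj₂ g)
        i′ = toℕ (proj₁ h)
        j′ = toℕ (proj₂ h)
        Y = (κ₁ g h * p + κ₂ g h * q , 0G)

      ρ-δ₁ : ∀ g h → ρ g + ρ h + β g h ≡ ρ (g +G h) + (κ₁ g h * p + κ₂ g h * q) ⟨mod K ⟩
      ρ-δ₁ g h = begin
        ρ g + ρ h + β g h                     ≡⟨ cong₂ (λ u v → ρ g + ρ h + β u v) (σ-image g) (σ-image h) ⟨
        ρ g + ρ h + β (Ext.image (σ g)) (Ext.image (σ h))  ≡⟨ centre-∙ (σ g) (σ h) ⟨
        Ext.centre (σ g ∙ σ h)                ≈⟨ ≈⇒centre (σ-∙ g h) ⟩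
        Ext.centre (σ (g +G h) ∙ (Y , 0G))    ≡⟨ centre-∙ (σ (g +G h)) (Y , 0G) ⟩
        ρ (g +G h) + Y + β (Ext.image (σ (g +G h))) 0G  ≈⟨ ⟨mod⟩-+ˡ (ρ (g +G h) + Y) (βg0≡0 _) ⟩
        ρ (g +G h) + Y + 0ℤ                   ≡⟨ ℤP.+-identityʳ _ ⟩
        ρ (g +G h) + Y                        ∎
        where
        open ⟨mod⟩-Reasoning K
        Y = κ₁ g h * p + κ₂ g h * q

      X : G → G → ℤ
      X g h = B 0G 0G + ((p * κ₁ g h + q * κ₂ g h) - δ₁ ρ g h)

      private
        unshift : ∀ B₀ ρg ρh B → B ≡ ((ρg + ρh + (B - B₀)) - (ρg + ρh)) + B₀
        unshift = solve-∀

        regroup : ∀ B₀ ρg ρh ρgh κ₁′ κ₂′ → ((ρgh + (κ₁′ + κ₂′)) - (ρg + ρh)) + B₀ ≡ B₀ + ((κ₁′ + κ₂′) - ((ρh - ρgh) + ρg))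
        regroup = solve-∀

      B≡X : ∀ g h → B g h ≡ X g h ⟨mod K ⟩
      B≡X g h = begin
        B g h                                                  ≡⟨ unshift (B 0G 0G) (ρ g) (ρ h) (B g h) ⟩
        ((ρ g + ρ h + β g h) - (ρ g + ρ h)) + B 0G 0G          ≈⟨ ⟨mod⟩-+ʳ (B 0G 0G) (⟨mod⟩-+ʳ (- (ρ g + ρ h)) (ρ-δ₁ g h)) ⟩
        ((ρ (g +G h) + Y) - (ρ g + ρ h)) + B 0G 0G             ≡⟨ regroup (B 0G 0G) (ρ g) (ρ h) (ρ (g +G h)) (κ₁ g h * p) (κ₂ g h * q) ⟩
        B 0G 0G + (Y - δ₁ ρ g h)                               ≡⟨ cong (λ y → B 0G 0G + (y - δ₁ ρ g h)) (cong₂ _+_ (ℤP.*-comm (κ₁ g h) p) (ℤP.*-comm (κ₂ g h) q)) ⟩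
        X g h                                                  ∎
        where
        open ⟨mod⟩-Reasoning K
        Y = κ₁ g h * p + κ₂ g h * q

      δ₂X≡0 : ∀ g h k → δ₂ X g h k ≡ 0ℤ
      δ₂X≡0 g h k = begin
        δ₂ X g h k
          ≡⟨ δ₂-+ (λ _ _ → B 0G 0G) (λ u v → (p * κ₁ u v + q * κ₂ u v) - δ₁ ρ u v) g h k ⟩
        δ₂ (λ _ _ → B 0G 0G) g h k + δ₂ (λ u v → (p * κ₁ u v + q * κ₂ u v) - δ₁ ρ u v) g h k
          ≡⟨ cong₂ _+_ (δ₂-const (B 0G 0G) g h k) (δ₂-- (λ u v → p * κ₁ u v + q * κ₂ u v) (δ₁ ρ) g h k) ⟩
        0ℤ + (δ₂ (λ u v → p * κ₁ u v + q * κ₂ u v) g h k - δ₂ (δ₁ ρ) g h k)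
          ≡⟨ cong (λ x → 0ℤ + (x - δ₂ (δ₁ ρ) g h k)) (δ₂-+ (λ u v → p * κ₁ u v) (λ u v → q * κ₂ u v) g h k) ⟩
        0ℤ + ((δ₂ (λ u v → p * κ₁ u v) g h k + δ₂ (λ u v → q * κ₂ u v) g h k) - δ₂ (δ₁ ρ) g h k)
          ≡⟨ cong₂ (λ x y → 0ℤ + ((x + y) - δ₂ (δ₁ ρ) g h k)) (δ₂-*ˡ p κ₁ g h k) (δ₂-*ˡ q κ₂ g h k) ⟩
        0ℤ + ((p * δ₂ κ₁ g h k + q * δ₂ κ₂ g h k) - δ₂ (δ₁ ρ) g h k)
          ≡⟨ cong₂ (λ x y → 0ℤ + ((p * x + q * y) - δ₂ (δ₁ ρ) g h k)) (δ₂κ₁≡0 g h k) (δ₂κ₂≡0 g h k) ⟩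
        0ℤ + ((p * 0ℤ + q * 0ℤ) - δ₂ (δ₁ ρ) g h k)
          ≡⟨ cong (λ x → 0ℤ + ((p * 0ℤ + q * 0ℤ) - x)) (δ₂∘δ₁≡0 +G-assoc ρ g h k) ⟩
        0ℤ + ((p * 0ℤ + q * 0ℤ) - 0ℤ)
          ≡⟨ zero-identity p q ⟩
        0ℤ ∎
        where
        open ≡-Reasoning
        zero-identity : ∀ p q → 0ℤ + ((p * 0ℤ + q * 0ℤ) - 0ℤ) ≡ 0ℤ
        zero-identity = solve-∀

      integral-primitive : .{{_ : NonZero K}} → ∃ λ b → ∀ g h k → δ₂ b g h k ≡ c g h k
      integral-primitive = b , δ₂b≡c
        where
        open ≡-Reasoning
        b : G → G → ℤ
        b g h = _≡_⟨mod_⟩.quotient (B≡X g h)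
        B≡X+Kb : ∀ g h → B g h ≡ X g h + + K * b g h
        B≡X+Kb g h = trans (_≡_⟨mod_⟩.equality (B≡X g h)) (cong (λ x → X g h + x) (ℤP.*-comm (b g h) (+ K)))
        δ₂b≡c : ∀ g h k → δ₂ b g h k ≡ c g h k
        δ₂b≡c g h k = ℤP.*-cancelˡ-≡ (+ K) (δ₂ b g h k) (c g h k) (begin
          + K * δ₂ b g h k                              ≡⟨ ℤP.+-identityˡ _ ⟨
          0ℤ + + K * δ₂ b g h k                         ≡⟨ cong₂ _+_ (δ₂X≡0 g h k) (δ₂-*ˡ (+ K) b g h k) ⟨
          δ₂ X g h k + δ₂ (λ u v → + K * b u v) g h k   ≡⟨ δ₂-+ X (λ u v → + K * b u v) g h k ⟨
          δ₂ (λ u v → X u v + + K * b u v) g h k        ≡⟨ δ₂-cong B≡X+Kb g h k ⟨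
          δ₂ B g h k                                    ≡⟨ δ₂B≡Kc g h k ⟩
          + K * c g h k                                 ∎)

  Ω : C² → ℤ
  Ω φ = commutator (∑₁ (obstruction φ)) e₁ e₂

  δ₂∘∑₁-obstruction : ∀ φ → Is2Cocycle φ → ∀ g h k → δ₂ (∑₁ (obstruction φ)) g h k ≡ + N * obstruction φ g h k
  δ₂∘∑₁-obstruction φ φ-cocycle = δ₂∘∑₁ (obstruction φ) (obstruction-cocycle φ φ-cocycle)

  L : ℕ
  L = lcm m n

  -- Opaque because normalising gcd m n for variables m, n produces huge terms.
  opaque
    d : ℕ
    d = gcd m n

    d≡gcd : d ≡ gcd m n
    d≡gcd = refl

    d∣m : d ℕD.∣ m
    d∣m = gcd[m,n]∣m m n

    d∣n : d ℕD.∣ n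
    d∣n = gcd[m,n]∣n m n

    N≡d*L : N ≡ d ℕ.* L
    N≡d*L = sym (gcd*lcm m n)

    instance
      d≢0 : NonZero d
      d≢0 = ℕ.≢-nonZero (gcd[m,n]≢0 m n (inj₁ (ℕ.≢-nonZero⁻¹ m)))

  instance
    L≢0 : NonZero L
    L≢0 = ℕP.m*n≢0⇒n≢0 d {{subst NonZero N≡d*L N≢0}}

    +L≢0 : ℤ.NonZero (+ L)
    +L≢0 = L≢0

  L∣Ω : ∀ φ → Is2Cocycle φ → + L Signed.∣ Ω φ
  L∣Ω φ φ-cocycle = ∣ᵤ⇒∣ {+ L} {Ω φ} (lcm-least (∣⇒∣ᵤ {+ m} m∣Ω) (∣⇒∣ᵤ {+ n} n∣Ω))
    where
    B = ∑₁ (obstruction φ)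
    δ₂B≡Nc = δ₂∘∑₁-obstruction φ φ-cocycle
    n∣Ω : + n Signed.∣ Ω φ
    n∣Ω = ⟨mod⟩-cancel-factor m n (Ω φ) (m·commutator≡0 B (obstruction φ) δ₂B≡Nc)
    m∣Ω : + m Signed.∣ Ω φ
    m∣Ω = ⟨mod⟩-cancel-factor n m (Ω φ) (subst (λ K → + n * Ω φ ≡ 0ℤ ⟨mod K ⟩) (ℕP.*-comm m n) (n·commutator≡0 B (obstruction φ) δ₂B≡Nc))

  F : C² → ℤ
  F φ = exactQuotient (+ L) (Ω φ)

  F-unique : ∀ φ x → Ω φ ≡ x * + L → F φ ≡ x
  F-unique φ = exactQuotient-unique (+ L) (Ω φ)

  Ω≡F*L : ∀ φ → Is2Cocycle φ → Ω φ ≡ F φ * + L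
  Ω≡F*L φ φ-cocycle = trans Ω≡xL (cong (_* + L) (sym (F-unique φ x Ω≡xL)))
    where
    open Signed._∣_ (L∣Ω φ φ-cocycle) renaming (quotient to x; equality to Ω≡xL)

  private
    commutator-+-identity : ∀ a a′ b b′ → (a + a′) - (b + b′) ≡ (a - b) + (a′ - b′)
    commutator-+-identity = solve-∀

    commutator---identity : ∀ a a′ b b′ → (a - a′) - (b - b′) ≡ (a - b) - (a′ - b′)
    commutator---identity = solve-∀

    coboundary-identity : ∀ N a b x → (N * a - x) - (N * b - x) ≡ (a - b) * N
    coboundary-identity = solve-∀

    δ₁-symmetric-identity : ∀ a b c → (a - c) + b ≡ (b - c) + a
    δ₁-symmetric-identity = solve-∀

  Ω-+ : ∀ φ φ′ → Ω (φ +C φ′) ≡ Ω φ + Ω φ′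
  Ω-+ φ φ′ = trans (cong₂ _-_ (∑₁-obstruction-+ e₁ e₂) (∑₁-obstruction-+ e₂ e₁))
                   (commutator-+-identity (∑₁ (obstruction φ) e₁ e₂) (∑₁ (obstruction φ′) e₁ e₂)
                                          (∑₁ (obstruction φ) e₂ e₁) (∑₁ (obstruction φ′) e₂ e₁))
    where
    ∑₁-obstruction-+ : ∀ g h → ∑₁ (obstruction (φ +C φ′)) g h ≡ ∑₁ (obstruction φ) g h + ∑₁ (obstruction φ′) g h
    ∑₁-obstruction-+ g h = trans (∑-cong (λ x → δ²-+ φ φ′ x g h 0G)) (∑-+ (λ x → obstruction φ x g h) (λ x → obstruction φ′ x g h))

  Ω-- : ∀ φ φ′ → Ω (φ -C φ′) ≡ Ω φ - Ω φ′
  Ω-- φ φ′ = trans (cong₂ _-_ (∑₁-obstruction-- e₁ e₂) (∑₁-obstruction-- e₂ e₁))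
                   (commutator---identity (∑₁ (obstruction φ) e₁ e₂) (∑₁ (obstruction φ′) e₁ e₂)
                                          (∑₁ (obstruction φ) e₂ e₁) (∑₁ (obstruction φ′) e₂ e₁))
    where
    ∑₁-obstruction-- : ∀ g h → ∑₁ (obstruction (φ -C φ′)) g h ≡ ∑₁ (obstruction φ) g h - ∑₁ (obstruction φ′) g h
    ∑₁-obstruction-- g h = trans (∑-cong (λ x → δ²-- φ φ′ x g h 0G)) (∑-- (λ x → obstruction φ x g h) (λ x → obstruction φ′ x g h))

  δ₁-symmetric : ∀ f g h → δ₁ f g h ≡ δ₁ f h g
  δ₁-symmetric f g h = trans (δ₁-symmetric-identity (f h) (f g) (f (g +G h))) (cong (λ x → (f g - f x) + f h) (+G-comm g h))

  commutator-∑₁∘δ₂ : ∀ f → commutator (∑₁ (δ₂ f)) e₁ e₂ ≡ commutator f e₁ e₂ * + N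
  commutator-∑₁∘δ₂ f = begin
    ∑₁ (δ₂ f) e₁ e₂ - ∑₁ (δ₂ f) e₂ e₁
      ≡⟨ cong₂ _-_ (∑₁∘δ₂ f e₁ e₂) (trans (∑₁∘δ₂ f e₂ e₁) (cong (λ x → + N * f e₂ e₁ - x) (δ₁-symmetric F′ e₂ e₁))) ⟩
    (+ N * f e₁ e₂ - δ₁ F′ e₁ e₂) - (+ N * f e₂ e₁ - δ₁ F′ e₁ e₂)
      ≡⟨ coboundary-identity (+ N) (f e₁ e₂) (f e₂ e₁) (δ₁ F′ e₁ e₂) ⟩
    commutator f e₁ e₂ * + N ∎
    where
    open ≡-Reasoning
    F′ : G → ℤ
    F′ h = ∑ (λ x → f x h)

  Ω-coboundary : ∀ θ ψ (e : G → G → ℤ) → (∀ g h y → θ g h y ≡ δ¹ ψ g h y + e g h) → Ω θ ≡ commutator e e₁ e₂ * + N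
  Ω-coboundary θ ψ e θ≡δ¹ψ+e = trans (cong₂ _-_ (∑₁-obstruction≡ e₁ e₂) (∑₁-obstruction≡ e₂ e₁)) (commutator-∑₁∘δ₂ e)
    where
    obstruction≡δ₂e : ∀ g h k → obstruction θ g h k ≡ δ₂ e g h k
    obstruction≡δ₂e g h k = trans (δ²-shift θ (δ¹ ψ) e θ≡δ¹ψ+e g h k 0G)
                                  (trans (cong (_+ δ₂ e g h k) (δ²∘δ¹≡0 ψ g h k 0G)) (ℤP.+-identityˡ _))
    ∑₁-obstruction≡ : ∀ g h → ∑₁ (obstruction θ) g h ≡ ∑₁ (δ₂ e) g h
    ∑₁-obstruction≡ g h = ∑-cong (λ x → obstruction≡δ₂e x g h)

  F≡⇒Ω≡ : ∀ φ φ′ → Is2Cocycle φ → Is2Cocycle φ′ → F φ ≡ F φ′ ⟨mod d ⟩ → Ω φ ≡ Ω φ′ ⟨mod N ⟩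
  F≡⇒Ω≡ φ φ′ φ-cocycle φ′-cocycle F≡ = subst (λ K → Ω φ ≡ Ω φ′ ⟨mod K ⟩) (sym N≡d*L)
    (subst₂ (λ a b → a ≡ b ⟨mod d ℕ.* L ⟩) (sym (Ω≡F*L φ φ-cocycle)) (sym (Ω≡F*L φ′ φ′-cocycle)) (⟨mod⟩-scale L F≡))

  Ω≡⇒F≡ : ∀ φ φ′ → Is2Cocycle φ → Is2Cocycle φ′ → Ω φ ≡ Ω φ′ ⟨mod N ⟩ → F φ ≡ F φ′ ⟨mod d ⟩
  Ω≡⇒F≡ φ φ′ φ-cocycle φ′-cocycle Ω≡ = ⟨mod⟩-unscale L
    (subst₂ (λ a b → a ≡ b ⟨mod d ℕ.* L ⟩) (Ω≡F*L φ φ-cocycle) (Ω≡F*L φ′ φ′-cocycle) (subst (λ K → Ω φ ≡ Ω φ′ ⟨mod K ⟩) N≡d*L Ω≡))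

  F-respects-∼ : ∀ φ φ′ → Is2Cocycle φ → Is2Cocycle φ′ → φ ∼ φ′ → F φ ≡ F φ′ [mod d ]
  F-respects-∼ φ φ′ φ-cocycle φ′-cocycle (ψ , φ-φ′≈δ¹ψ) = ⟨mod⟩⇒[mod] (Ω≡⇒F≡ φ φ′ φ-cocycle φ′-cocycle (⟨mod⟩-difference⁻
    (commutator e e₁ e₂ , trans (sym (Ω-- φ φ′)) (trans (Ω-coboundary (φ -C φ′) ψ e (λ g h → proj₂ (φ-φ′≈δ¹ψ g h tt tt)))
                                                        (sym (ℤP.+-identityˡ _))))))
    where
    e : G → G → ℤ
    e g h = proj₁ (φ-φ′≈δ¹ψ g h tt tt)

  F-+ : ∀ φ φ′ → Is2Cocycle φ → Is2Cocycle φ′ → F (φ +C φ′) ≡ F φ + F φ′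
  F-+ φ φ′ φ-cocycle φ′-cocycle = F-unique (φ +C φ′) (F φ + F φ′) (begin
    Ω (φ +C φ′)              ≡⟨ Ω-+ φ φ′ ⟩
    Ω φ + Ω φ′               ≡⟨ cong₂ _+_ (Ω≡F*L φ φ-cocycle) (Ω≡F*L φ′ φ′-cocycle) ⟩
    F φ * + L + F φ′ * + L   ≡⟨ ℤP.*-distribʳ-+ (+ L) (F φ) (F φ′) ⟨
    (F φ + F φ′) * + L       ∎)
    where open ≡-Reasoning

  F-injective : ∀ φ φ′ → Is2Cocycle φ → Is2Cocycle φ′ → F φ ≡ F φ′ [mod d ] → φ ∼ φ′
  F-injective φ φ′ φ-cocycle φ′-cocycle F≡ =
    integral-obstruction⇒coboundary θ b (λ g h k y → trans (cocycle⇒δ²-constant θ θ-cocycle g h k y) (sym (δ₂b≡c g h k)))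
    where
    θ = φ -C φ′
    θ-cocycle = Is2Cocycle-- φ φ′ φ-cocycle φ′-cocycle
    B = ∑₁ (obstruction θ)
    c = obstruction θ
    δ₂B≡Nc = δ₂∘∑₁-obstruction θ θ-cocycle
    symmetric : B e₁ e₂ ≡ B e₂ e₁ ⟨mod N ⟩
    symmetric = ⟨mod⟩-difference⁻ (subst (λ ω → ω ≡ 0ℤ ⟨mod N ⟩) (sym (Ω-- φ φ′))
                  (⟨mod⟩-difference⁺ (F≡⇒Ω≡ φ φ′ φ-cocycle φ′-cocycle ([mod]⇒⟨mod⟩ (F φ) (F φ′) F≡))))
    lift = Extension.integral-primitive B c δ₂B≡Nc symmetric
    b = proj₁ lift
    δ₂b≡c = proj₂ lift

  m′ n′ : ℕ
  m′ = ℕD.quotient (d∣m)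
  n′ = ℕD.quotient (d∣n)

  m≡m′*d : + m ≡ + m′ * + d
  m≡m′*d = trans (cong +_ (ℕD._∣_.equality (d∣m))) (ℤP.pos-* m′ d)

  n≡n′*d : + n ≡ + n′ * + d
  n≡n′*d = trans (cong +_ (ℕD._∣_.equality (d∣n))) (ℤP.pos-* n′ d)

  c₀ : G → G → G → ℤ
  c₀ g h k = + m′ * κ₁ g h * ℓ₂ k - + n′ * (ℓ₁ g * κ₂ h k)

  private
    c₀-identity : ∀ m′ n′ d κ₁ ℓ₂ ℓ₁ κ₂ → (m′ * d) * κ₁ * ℓ₂ - ℓ₁ * ((n′ * d) * κ₂) ≡ d * (m′ * κ₁ * ℓ₂ - n′ * (ℓ₁ * κ₂))
    c₀-identity = solve-∀

  δ₂[ℓ₁∪ℓ₂]≡d*c₀ : ∀ g h k → δ₂ (ℓ₁ ∪ ℓ₂) g h k ≡ + d * c₀ g h k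
  δ₂[ℓ₁∪ℓ₂]≡d*c₀ g h k = begin
    δ₂ (ℓ₁ ∪ ℓ₂) g h k                              ≡⟨ δ₂-∪ ℓ₁ ℓ₂ g h k ⟩
    δ₁ ℓ₁ g h * ℓ₂ k - ℓ₁ g * δ₁ ℓ₂ h k             ≡⟨ cong₂ (λ x y → x * ℓ₂ k - ℓ₁ g * y) (δ₁ℓ₁≡m*κ₁ g h) (δ₁ℓ₂≡n*κ₂ h k) ⟩
    + m * κ₁ g h * ℓ₂ k - ℓ₁ g * (+ n * κ₂ h k)     ≡⟨ cong₂ (λ x y → x * κ₁ g h * ℓ₂ k - ℓ₁ g * (y * κ₂ h k)) m≡m′*d n≡n′*d ⟩
    (+ m′ * + d) * κ₁ g h * ℓ₂ k - ℓ₁ g * ((+ n′ * + d) * κ₂ h k)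
                                                    ≡⟨ c₀-identity (+ m′) (+ n′) (+ d) (κ₁ g h) (ℓ₂ k) (ℓ₁ g) (κ₂ h k) ⟩
    + d * c₀ g h k                                  ∎
    where open ≡-Reasoning

  δ₃c₀≡0 : ∀ g h k l → δ₃ c₀ g h k l ≡ 0ℤ
  δ₃c₀≡0 = δ₂≡M*c⇒δ₃c≡0 +G-assoc d (ℓ₁ ∪ ℓ₂) c₀ δ₂[ℓ₁∪ℓ₂]≡d*c₀

  δ₃[M*c₀]≡0 : ∀ M g h k l → δ₃ (λ g h k → M * c₀ g h k) g h k l ≡ 0ℤ
  δ₃[M*c₀]≡0 M g h k l = trans (δ₃-*ˡ M c₀ g h k l) (trans (cong (M *_) (δ₃c₀≡0 g h k l)) (ℤP.*-zeroʳ M))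

  witness : ℤ → C²
  witness M = realisation (λ g h k → M * c₀ g h k)

  witness-cocycle : ∀ M → Is2Cocycle (witness M)
  witness-cocycle M = realisation-cocycle (λ g h k → M * c₀ g h k) (δ₃[M*c₀]≡0 M)

  ω₁₂ : ℤ
  ω₁₂ = commutator (ℓ₁ ∪ ℓ₂) e₁ e₂

  private
    d*∑₁c₀ : ∀ g h → + d * ∑₁ c₀ g h ≡ ∑₁ (δ₂ (ℓ₁ ∪ ℓ₂)) g h
    d*∑₁c₀ g h = trans (sym (∑-*ˡ (+ d) (λ x → c₀ x g h))) (∑-cong (λ x → sym (δ₂[ℓ₁∪ℓ₂]≡d*c₀ x g h)))

    distribute-identity : ∀ d M a b → d * (M * a - M * b) ≡ M * (d * a - d * b)
    distribute-identity = solve-∀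

    final-identity : ∀ M e d L → M * (e * (d * L)) ≡ d * (M * e * L)
    final-identity = solve-∀

  ∑₁-obstruction-witness : ∀ M g h → ∑₁ (obstruction (witness M)) g h ≡ M * ∑₁ c₀ g h
  ∑₁-obstruction-witness M g h = trans (∑-cong (λ x → δ²-realisation (λ g h k → M * c₀ g h k) (δ₃[M*c₀]≡0 M) x g h 0G))
                                       (∑-*ˡ M (λ x → c₀ x g h))

  Ω-witness : ∀ M → Ω (witness M) ≡ (M * ω₁₂) * + L
  Ω-witness M = ℤP.*-cancelˡ-≡ (+ d) _ _ (begin
    + d * Ω (witness M)
      ≡⟨ cong (+ d *_) (cong₂ _-_ (∑₁-obstruction-witness M e₁ e₂) (∑₁-obstruction-witness M e₂ e₁)) ⟩
    + d * (M * ∑₁ c₀ e₁ e₂ - M * ∑₁ c₀ e₂ e₁)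
      ≡⟨ distribute-identity (+ d) M (∑₁ c₀ e₁ e₂) (∑₁ c₀ e₂ e₁) ⟩
    M * (+ d * ∑₁ c₀ e₁ e₂ - + d * ∑₁ c₀ e₂ e₁)
      ≡⟨ cong (M *_) (cong₂ _-_ (d*∑₁c₀ e₁ e₂) (d*∑₁c₀ e₂ e₁)) ⟩
    M * commutator (∑₁ (δ₂ (ℓ₁ ∪ ℓ₂))) e₁ e₂
      ≡⟨ cong (M *_) (commutator-∑₁∘δ₂ (ℓ₁ ∪ ℓ₂)) ⟩
    M * (ω₁₂ * + N)
      ≡⟨ cong (λ x → M * (ω₁₂ * x)) (trans (cong +_ N≡d*L) (ℤP.pos-* d L)) ⟩
    M * (ω₁₂ * (+ d * + L))
      ≡⟨ final-identity M ω₁₂ (+ d) (+ L) ⟩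
    + d * ((M * ω₁₂) * + L) ∎)
    where
    open ≡-Reasoning
    instance
      +d≢0 : ℤ.NonZero (+ d)
      +d≢0 = d≢0

  private
    lift-𝟙≡1 : ∀ k .{{_ : NonZero k}} → ℤmod.lift k (ℤmod.𝟙 k) ≡ 1ℤ ⟨mod k ⟩
    lift-𝟙≡1 k = ⟨mod⟩-intro (+ (1 ℕ./ k)) (ℤmod.lift-mod k 1)

    drop-zero : ∀ a b → a - 0ℤ * b ≡ a
    drop-zero = solve-∀

  ω₁₂≡1 : ω₁₂ ≡ 1ℤ ⟨mod d ⟩
  ω₁₂≡1 = begin
    ω₁₂                              ≡⟨ cong (λ x → ℓ₁ e₁ * ℓ₂ e₂ - x * ℓ₂ e₁) (cong +_ C₁.toℕ-𝟘) ⟩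
    ℓ₁ e₁ * ℓ₂ e₂ - 0ℤ * ℓ₂ e₁       ≡⟨ drop-zero (ℓ₁ e₁ * ℓ₂ e₂) (ℓ₂ e₁) ⟩
    ℓ₁ e₁ * ℓ₂ e₂                    ≈⟨ ⟨mod⟩-* (⟨mod⟩-weaken (d∣m) (lift-𝟙≡1 m)) (⟨mod⟩-weaken (d∣n) (lift-𝟙≡1 n)) ⟩
    1ℤ * 1ℤ                          ≡⟨⟩
    1ℤ                               ∎
    where open ⟨mod⟩-Reasoning d

  F-witness : ∀ M → F (witness M) ≡ M ⟨mod d ⟩
  F-witness M = begin
    F (witness M)  ≡⟨ F-unique (witness M) (M * ω₁₂) (Ω-witness M) ⟩
    M * ω₁₂        ≈⟨ ⟨mod⟩-*ˡ M ω₁₂≡1 ⟩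
    M * 1ℤ         ≡⟨ ℤP.*-identityʳ M ⟩
    M              ∎
    where open ⟨mod⟩-Reasoning d

  module Cyclic (x : G) where

    S : G → Set
    S = ⟨ x ⟩

    S-+ : ∀ {g h} → S g → S h → S (g +G h)
    S-+ (k , refl) (l , refl) = k ℕ.+ l , sym (·G-homo-+ k l x)

    ·G-mod : ∀ j → (j % N) ·G x ≡ j ·G x
    ·G-mod j = sym (begin
      j ·G x                                   ≡⟨ cong (_·G x) (m≡m%n+[m/n]*n j N) ⟩
      (j % N ℕ.+ j / N ℕ.* N) ·G x             ≡⟨ ·G-homo-+ (j % N) (j / N ℕ.* N) x ⟩
      (j % N) ·G x +G (j / N ℕ.* N) ·G x       ≡⟨ cong ((j % N) ·G x +G_) (N·x≡0 (j / N) x) ⟩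
      (j % N) ·G x +G 0G                       ≡⟨ +G-identityʳ _ ⟩
      (j % N) ·G x                             ∎)
      where open ≡-Reasoning

    -G-multiple : ∀ i → -G (i ·G x) ≡ ((N ∸ 1) ℕ.* i) ·G x
    -G-multiple i = sym (inverseʳ-unique (i ·G x) (((N ∸ 1) ℕ.* i) ·G x) (begin
      i ·G x +G ((N ∸ 1) ℕ.* i) ·G x     ≡⟨ ·G-homo-+ i ((N ∸ 1) ℕ.* i) x ⟨
      (i ℕ.+ (N ∸ 1) ℕ.* i) ·G x         ≡⟨ cong (_·G x) i+[N∸1]i≡iN ⟩
      (i ℕ.* N) ·G x                     ≡⟨ N·x≡0 i x ⟩
      0G                                 ∎))
      where
      open ≡-Reasoning
      i+[N∸1]i≡iN : i ℕ.+ (N ∸ 1) ℕ.* i ≡ i ℕ.* N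
      i+[N∸1]i≡iN = trans (cong (λ k → k ℕ.* i) (ℕP.m+[n∸m]≡n {1} {N} (ℕ.>-nonZero⁻¹ N))) (ℕP.*-comm N i)

    code : G → ℕ
    code u = toℕ (Inverse.from (*↔× {m} {n}) u)

    code-injective : ∀ {u v} → code u ≡ code v → u ≡ v
    code-injective {u} {v} eq = begin
      u                        ≡⟨ strictlyInverseˡ u ⟨
      to (from u)              ≡⟨ cong to (toℕ-injective eq) ⟩
      to (from v)              ≡⟨ strictlyInverseˡ v ⟩
      v                        ∎
      where
      open ≡-Reasoning
      open Inverse (*↔× {m} {n}) using (to; from; strictlyInverseˡ)

    coset : G → List G
    coset y = map (λ j → y +G j ·G x) (upTo N)

    rep : G → G
    rep y = argmin code y (coset y)

    rep∈coset : ∀ y → ∃ λ j → rep y ≡ y +G j ·G x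
    rep∈coset y = argmin-all code {P = λ z → ∃ λ j → z ≡ y +G j ·G x} (0 , sym (+G-identityʳ y))
                    (map⁺ (All.universal (λ j → j , refl) (upTo N)))

    rep-minimal : ∀ y j → code (rep y) ≤ code (y +G j ·G x)
    rep-minimal y j = subst (λ z → code (rep y) ≤ code (y +G z)) (·G-mod j)
      (All.lookup (f[argmin]≤f[xs] {f = code} y (coset y)) (∈-map⁺ (λ j → y +G j ·G x) (∈-upTo⁺ (m%n<n j N))))

    private
      y-ix+[i+j]x≡y+jx : ∀ y i j → (y +G -G (i ·G x)) +G (i ℕ.+ j) ·G x ≡ y +G j ·G x
      y-ix+[i+j]x≡y+jx y i j = begin
        (y +G -G (i ·G x)) +G (i ℕ.+ j) ·G x      ≡⟨ cong (y +G -G (i ·G x) +G_) (·G-homo-+ i j x) ⟩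
        (y +G -G (i ·G x)) +G (i ·G x +G j ·G x)  ≡⟨ +G-assoc y (-G (i ·G x)) _ ⟩
        y +G (-G (i ·G x) +G (i ·G x +G j ·G x))  ≡⟨ cong (y +G_) (+G-assoc (-G (i ·G x)) (i ·G x) (j ·G x)) ⟨
        y +G ((-G (i ·G x) +G i ·G x) +G j ·G x)  ≡⟨ cong (λ z → y +G (z +G j ·G x)) (+G-inverseˡ (i ·G x)) ⟩
        y +G (0G +G j ·G x)                       ≡⟨ cong (y +G_) (+G-identityˡ (j ·G x)) ⟩
        y +G j ·G x                               ∎
        where open ≡-Reasoning

      y+[[N∸1]i+j]x≡y-ix+jx : ∀ y i j → y +G ((N ∸ 1) ℕ.* i ℕ.+ j) ·G x ≡ (y +G -G (i ·G x)) +G j ·G x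
      y+[[N∸1]i+j]x≡y-ix+jx y i j = begin
        y +G ((N ∸ 1) ℕ.* i ℕ.+ j) ·G x           ≡⟨ cong (y +G_) (·G-homo-+ ((N ∸ 1) ℕ.* i) j x) ⟩
        y +G (((N ∸ 1) ℕ.* i) ·G x +G j ·G x)     ≡⟨ cong (λ z → y +G (z +G j ·G x)) (-G-multiple i) ⟨
        y +G (-G (i ·G x) +G j ·G x)              ≡⟨ +G-assoc y (-G (i ·G x)) (j ·G x) ⟨
        (y +G -G (i ·G x)) +G j ·G x              ∎
        where open ≡-Reasoning

    rep-invariant : ∀ {g} → S g → ∀ y → rep (y +G -G g) ≡ rep y
    rep-invariant {g} (i , refl) y = code-injective (ℕP.≤-antisym rep′≤rep rep≤rep′)
      where
      open ℕP.≤-Reasoning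
      y′ = y +G -G (i ·G x)
      j = proj₁ (rep∈coset y)
      j′ = proj₁ (rep∈coset y′)

      rep′≤rep : code (rep y′) ≤ code (rep y)
      rep′≤rep = begin
        code (rep y′)                   ≤⟨ rep-minimal y′ (i ℕ.+ j) ⟩
        code (y′ +G (i ℕ.+ j) ·G x)     ≡⟨ cong code (y-ix+[i+j]x≡y+jx y i j) ⟩
        code (y +G j ·G x)              ≡⟨ cong code (proj₂ (rep∈coset y)) ⟨
        code (rep y)                    ∎

      rep≤rep′ : code (rep y) ≤ code (rep y′)
      rep≤rep′ = begin
        code (rep y)                              ≤⟨ rep-minimal y ((N ∸ 1) ℕ.* i ℕ.+ j′) ⟩
        code (y +G ((N ∸ 1) ℕ.* i ℕ.+ j′) ·G x)   ≡⟨ cong code (y+[[N∸1]i+j]x≡y-ix+jx y i j′) ⟩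
        code (y′ +G j′ ·G x)                      ≡⟨ cong code (proj₂ (rep∈coset y′)) ⟨
        code (rep y′)                             ∎

    τ : G → G
    τ y = rep y +G -G y

    τ∈S : ∀ y → S (τ y)
    τ∈S y with j , rep-y ← rep∈coset y = j , (begin
      rep y +G -G y              ≡⟨ cong (_+G -G y) rep-y ⟩
      (y +G j ·G x) +G -G y      ≡⟨ cong (_+G -G y) (+G-comm y (j ·G x)) ⟩
      (j ·G x +G y) +G -G y      ≡⟨ +G-assoc (j ·G x) y (-G y) ⟩
      j ·G x +G (y +G -G y)      ≡⟨ cong (j ·G x +G_) (+G-inverseʳ y) ⟩
      j ·G x +G 0G               ≡⟨ +G-identityʳ (j ·G x) ⟩
      j ·G x                     ∎)
      where open ≡-Reasoning

    τ-shift : ∀ {g} → S g → ∀ y → τ (y +G -G g) ≡ τ y +G g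
    τ-shift {g} Sg y = begin
      rep (y +G -G g) +G -G (y +G -G g)  ≡⟨ cong₂ _+G_ (rep-invariant Sg y) (-G[y-g]≡-Gy+g y g) ⟩
      rep y +G (-G y +G g)               ≡⟨ +G-assoc (rep y) (-G y) g ⟨
      τ y +G g                           ∎
      where open ≡-Reasoning

    index : G → ℕ
    index g with any? (λ (k : Fin N) → toℕ k ·G x ≟G g)
    ... | yes (k , _) = toℕ k
    ... | no  _       = 0

    index-spec : ∀ {g} → S g → index g ·G x ≡ g
    index-spec {g} (k , g≡kx) with any? (λ (k : Fin N) → toℕ k ·G x ≟G g)
    ... | yes (_ , kx≡g) = kx≡g
    ... | no  ∄          = contradiction (fromℕ< (m%n<n k N) , trans (cong (_·G x) (toℕ-fromℕ< _)) (trans (·G-mod k) (sym g≡kx))) ∄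

    X₁ X₂ : ℤ
    X₁ = ℓ₁ x
    X₂ = ℓ₂ x

    ℓ₁-·G : ∀ k → ℓ₁ (k ·G x) + + ((k ℕ.* toℕ (proj₁ x)) / m) * + m ≡ + k * X₁
    ℓ₁-·G k = trans (cong (λ g → ℓ₁ g + + ((k ℕ.* toℕ (proj₁ x)) / m) * + m) (·G-coordinates k x))
                    (trans (C₁.lift-mod (k ℕ.* toℕ (proj₁ x))) (ℤP.pos-* k (toℕ (proj₁ x))))

    ℓ₂-·G : ∀ k → ℓ₂ (k ·G x) + + ((k ℕ.* toℕ (proj₂ x)) / n) * + n ≡ + k * X₂
    ℓ₂-·G k = trans (cong (λ g → ℓ₂ g + + ((k ℕ.* toℕ (proj₂ x)) / n) * + n) (·G-coordinates k x))
                    (trans (C₂.lift-mod (k ℕ.* toℕ (proj₂ x))) (ℤP.pos-* k (toℕ (proj₂ x))))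

    private
      solve-for-lift : ∀ ℓ a M {p} → ℓ + a * M ≡ p → ℓ ≡ p - a * M
      solve-for-lift ℓ a M refl = identity ℓ a M
        where
        identity : ∀ ℓ a M → ℓ ≡ (ℓ + a * M) - a * M
        identity = solve-∀

      lift-difference : ∀ ℓ a b M {p q} → ℓ + a * M ≡ p → ℓ + b * M ≡ q → p - q ≡ (a - b) * M
      lift-difference ℓ a b M refl refl = identity ℓ a b M
        where
        identity : ∀ ℓ a b M → (ℓ + a * M) - (ℓ + b * M) ≡ (a - b) * M
        identity = solve-∀

      split-sum : ∀ k l j X → (+ k + + l - + j) * X ≡ + (k ℕ.+ l) * X - + j * X
      split-sum k l j X = trans (identity (+ k) (+ l) (+ j) X) (cong (λ s → s * X - + j * X) (sym (ℤP.pos-+ k l)))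
        where
        identity : ∀ k l j X → (k + l - j) * X ≡ (k + l) * X - j * X
        identity = solve-∀

    Γ : G → ℤ
    Γ g = - (1ℤ + + d) * X₁ * X₂ * (+ index g * + index g)

    Λ : G → G → ℤ
    Λ g h = + 2 * (ℓ₁ ∪ ℓ₂) g h - δ₁ Γ g h

    Λ-divisible-on-S : ∀ {g h} → S g → S h → ∃ λ Q → Λ g h ≡ Q * (+ 2 * + d)
    Λ-divisible-on-S {g} {h} Sg Sh =
      Λ-divisible {ℓ₁ g} {ℓ₂ h} {+ k} {+ l} {+ j} {X₁} {X₂} {q₁ k} {q₂ l} {q₁ (k ℕ.+ l) - q₁ j} {q₂ (k ℕ.+ l) - q₂ j}
                  {+ m} {+ n} {+ m′} {+ n′} {+ d} {proj₁ (consecutive-product-even d)}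
                  ℓ₁g≡ ℓ₂h≡ m≡m′*d n≡n′*d [k+l-j]X₁≡ [k+l-j]X₂≡ (proj₂ (consecutive-product-even d))
      where
      k = index g
      l = index h
      j = index (g +G h)
      q₁ q₂ : ℕ → ℤ
      q₁ i = + ((i ℕ.* toℕ (proj₁ x)) / m)
      q₂ i = + ((i ℕ.* toℕ (proj₂ x)) / n)
      [k+l]x≡jx : (k ℕ.+ l) ·G x ≡ j ·G x
      [k+l]x≡jx = trans (·G-homo-+ k l x) (trans (cong₂ _+G_ (index-spec Sg) (index-spec Sh)) (sym (index-spec (S-+ Sg Sh))))
      ℓ₁g≡ : ℓ₁ g ≡ + k * X₁ - q₁ k * + m
      ℓ₁g≡ = solve-for-lift (ℓ₁ g) (q₁ k) (+ m) (subst (λ u → ℓ₁ u + q₁ k * + m ≡ + k * X₁) (index-spec Sg) (ℓ₁-·G k))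
      ℓ₂h≡ : ℓ₂ h ≡ + l * X₂ - q₂ l * + n
      ℓ₂h≡ = solve-for-lift (ℓ₂ h) (q₂ l) (+ n) (subst (λ u → ℓ₂ u + q₂ l * + n ≡ + l * X₂) (index-spec Sh) (ℓ₂-·G l))
      [k+l-j]X₁≡ : (+ k + + l - + j) * X₁ ≡ (q₁ (k ℕ.+ l) - q₁ j) * + m
      [k+l-j]X₁≡ = trans (split-sum k l j X₁) (lift-difference (ℓ₁ ((k ℕ.+ l) ·G x)) (q₁ (k ℕ.+ l)) (q₁ j) (+ m)
                     (ℓ₁-·G (k ℕ.+ l)) (subst (λ u → ℓ₁ u + q₁ j * + m ≡ + j * X₁) (sym [k+l]x≡jx) (ℓ₁-·G j)))
      [k+l-j]X₂≡ : (+ k + + l - + j) * X₂ ≡ (q₂ (k ℕ.+ l) - q₂ j) * + n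
      [k+l-j]X₂≡ = trans (split-sum k l j X₂) (lift-difference (ℓ₂ ((k ℕ.+ l) ·G x)) (q₂ (k ℕ.+ l)) (q₂ j) (+ n)
                     (ℓ₂-·G (k ℕ.+ l)) (subst (λ u → ℓ₂ u + q₂ j * + n ≡ + j * X₂) (sym [k+l]x≡jx) (ℓ₂-·G j)))

    instance
      2d≢0 : ℤ.NonZero (+ 2 * + d)
      2d≢0 = ℤP.i*j≢0 (+ 2) (+ d)

    b₀ : G → G → ℤ
    b₀ g h = exactQuotient (+ 2 * + d) (Λ g h)

    Λ≡b₀*2d : ∀ {g h} → S g → S h → Λ g h ≡ b₀ g h * (+ 2 * + d)
    Λ≡b₀*2d {g} {h} Sg Sh =
      trans Λ≡Q*2d (cong (_* (+ 2 * + d)) (sym (exactQuotient-unique (+ 2 * + d) (Λ g h) Q Λ≡Q*2d)))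
      where
      Q = proj₁ (Λ-divisible-on-S Sg Sh)
      Λ≡Q*2d = proj₂ (Λ-divisible-on-S Sg Sh)

    private
      doubling : ∀ d c → + 2 * (d * c) - 0ℤ ≡ (+ 2 * d) * c
      doubling = solve-∀

    δ₂b₀≡c₀ : ∀ {g h k} → S g → S h → S k → δ₂ b₀ g h k ≡ c₀ g h k
    δ₂b₀≡c₀ {g} {h} {k} Sg Sh Sk = ℤP.*-cancelˡ-≡ (+ 2 * + d) (δ₂ b₀ g h k) (c₀ g h k) (begin
      (+ 2 * + d) * δ₂ b₀ g h k                                    ≡⟨ δ₂-*ˡ (+ 2 * + d) b₀ g h k ⟨
      δ₂ (λ u v → (+ 2 * + d) * b₀ u v) g h k                      ≡⟨ δ₂-congOn S S-+ {λ u v → (+ 2 * + d) * b₀ u v} {Λ} (λ {u} {v} Su Sv → trans (ℤP.*-comm (+ 2 * + d) (b₀ u v)) (sym (Λ≡b₀*2d Su Sv))) Sg Sh Sk ⟩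
      δ₂ Λ g h k                                                   ≡⟨ δ₂-- (λ u v → + 2 * (ℓ₁ ∪ ℓ₂) u v) (δ₁ Γ) g h k ⟩
      δ₂ (λ u v → + 2 * (ℓ₁ ∪ ℓ₂) u v) g h k - δ₂ (δ₁ Γ) g h k     ≡⟨ cong₂ _-_ (δ₂-*ˡ (+ 2) (ℓ₁ ∪ ℓ₂) g h k) (δ₂∘δ₁≡0 +G-assoc Γ g h k) ⟩
      + 2 * δ₂ (ℓ₁ ∪ ℓ₂) g h k - 0ℤ                               ≡⟨ cong (λ z → + 2 * z - 0ℤ) (δ₂[ℓ₁∪ℓ₂]≡d*c₀ g h k) ⟩
      + 2 * (+ d * c₀ g h k) - 0ℤ                                  ≡⟨ doubling (+ d) (c₀ g h k) ⟩
      (+ 2 * + d) * c₀ g h k                                       ∎)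
      where open ≡-Reasoning

    witness-trivial-on-⟨x⟩ : ∀ M → IsCoboundaryOn ⟨ x ⟩ (witness M)
    witness-trivial-on-⟨x⟩ M = integral-obstruction⇒coboundaryOn S S-+ τ τ∈S τ-shift (witness M) (λ g h → M * b₀ g h)
      (λ {g} {h} {k} Sg Sh Sk y → begin
        δ² (witness M) g h k y      ≡⟨ δ²-realisation (λ g h k → M * c₀ g h k) (δ₃[M*c₀]≡0 M) g h k y ⟩
        M * c₀ g h k               ≡⟨ cong (M *_) (δ₂b₀≡c₀ Sg Sh Sk) ⟨
        M * δ₂ b₀ g h k            ≡⟨ δ₂-*ˡ M b₀ g h k ⟨
        δ₂ (λ u v → M * b₀ u v) g h k ∎)
      where open ≡-Reasoning

  sha-iso : ShaIsoZmod d
  sha-iso = F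
          , (λ φ φ′ φ-sha φ′-sha → F-respects-∼ φ φ′ (proj₁ φ-sha) (proj₁ φ′-sha))
          , (λ φ φ′ φ-sha φ′-sha → ⟨mod⟩⇒[mod] (⟨mod⟩-reflexive (F-+ φ φ′ (proj₁ φ-sha) (proj₁ φ′-sha))))
          , (λ φ φ′ φ-sha φ′-sha → F-injective φ φ′ (proj₁ φ-sha) (proj₁ φ′-sha))
          , λ M → witness M , (witness-cocycle M , λ x → Cyclic.witness-trivial-on-⟨x⟩ x M) , ⟨mod⟩⇒[mod] (F-witness M)

proposition5p16 : (n₁ n₂ : ℕ) .{{nz₁ : NonZero n₁}} .{{nz₂ : NonZero n₂}} →
    CohomologyOf.ShaIsoZmod n₁ n₂ (gcd n₁ n₂)
proposition5p16 n₁ n₂ = subst (CohomologyOf.ShaIsoZmod n₁ n₂) (d≡gcd n₁ n₂) (sha-iso n₁ n₂)
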